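{- Let $n,q$ be positive integers, $\delta=\log_2 q$, $V\in[q]^n$ a fixed vector, and consider any algorithm in the cell-probe model with $w$-bit cells solving the online convolution problem on a sequence $\Delta=(\Delta_0,\dots,\Delta_{n-1})$ chosen uniformly at random from $[q]^n$ (operation $\mathrm{next}(\Delta_t)$ at time $t$). For any $t_0\le t_1<t_2$ in $[n]$ with $t_1-t_0+1=t_2-t_1=\ell$, $$\mathbb{E}\big[|IT(t_0,t_1,t_2)|\big]\ \ge\ \frac{\delta R_{V,\ell}}{2w}-\frac12.$$
   Context: $[q]=\{0,\dots,q-1\}$. Online convolution problem: maintain $A\in[q]^n$, initially all zeros; $\mathrm{next}(\Delta)$ replaces $A$ by $(A[1],\dots,A[n-1],\Delta)$ and returns $\langle A,V\rangle=\sum_iA[i]V[i]\bmod q$ before the next input arrives. Cell-probe model: memory of cells of $w$ bits, each cell able to hold the address of any cell; computation is free, the algorithm retains no information between operations except in memory, cost = number of cell reads/writes. Information transfer $IT(t_0,t_1,t_2)$: the set of memory cells $c$ that are written during time interval $[t_0,t_1]$, read at some time $t_r\in[t_1+1,t_2]$, and not written during $[t_1+1,t_r]$ before that read. $M_{V,\ell}$ is the $\ell\times\ell$ matrix over $\mathbb{Z}/q\mathbb{Z}$ with $M_{V,\ell}(i,j)=V[n-1-(\ell+i)+j]$, $i,j\in[\ell]$; the recovery number $R_{V,\ell}$ is the number of $k\in\{1,\dots,\ell\}$ such that any $x,x'\in(\mathbb{Z}/q\mathbb{Z})^\ell$ with $M_{V,\ell}x=M_{V,\ell}x'$ satisfy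 $x_k=x'_k$. -}

module Defs where

open import Data.Nat.Base using (ℕ; zero; suc; _+_; _*_; _∸_; _^_; _≤_; _<_; _≤ᵇ_; _<ᵇ_; _≡ᵇ_; _%_; NonZero)
open import Data.Bool.Base using (Bool; true; false; _∧_; _∨_; not; if_then_else_)
open import Data.Fin.Base using (Fin; toℕ)
open import Data.Vec.Base using (Vec; []; _∷_; lookup)
open import Data.List.Base using (List; []; _∷_; _++_; map; concatMap; allFin; upTo)
open import Data.Bool.ListAction using (any; all)
open import Data.Nat.ListAction using (sum)
open import Data.Product.Base using (_×_; _,_; proj₁; proj₂)
open import Relation.Binary.PropositionalEquality using (_≡_)

allVecs : (q m : ℕ) → List (Vec (Fin q) m)
allVecs q zero    = [] ∷ []
allVecs q (suc m) = concatMap (λ d → map (d ∷_) (allVecs q m)) (allFin q)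

count : {A : Set} → (A → Bool) → List A → ℕ
count p [] = 0
count p (x ∷ xs) = (if p x then 1 else 0) + count p xs

Σ< : ℕ → (ℕ → ℕ) → ℕ
Σ< m f = sum (map f (upTo m))

-- entries of a vector as natural numbers, 0 outside the range
at : {q m : ℕ} → Vec (Fin q) m → ℕ → ℕ
at [] i = 0
at (x ∷ xs) zero = toℕ x
at (x ∷ xs) (suc i) = at xs i

Mentry : {q n : ℕ} → Vec (Fin q) n → ℕ → ℕ → ℕ → ℕ
Mentry {n = n} V ℓ i j = at V (n ∸ 1 ∸ (ℓ + i) + j)

Mx : {q n ℓ : ℕ} .{{_ : NonZero q}} → Vec (Fin q) n → Vec (Fin q) ℓ → ℕ → ℕ
Mx {q} {ℓ = ℓ} V x i = Σ< ℓ (λ j → Mentry V ℓ i j * at x j) % q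

sameImage : {q n ℓ : ℕ} .{{_ : NonZero q}} → Vec (Fin q) n → Vec (Fin q) ℓ → Vec (Fin q) ℓ → Bool
sameImage {ℓ = ℓ} V x x' = all (λ i → Mx V x i ≡ᵇ Mx V x' i) (upTo ℓ)

recoverable : {q n : ℕ} .{{_ : NonZero q}} → Vec (Fin q) n → (ℓ : ℕ) → Fin ℓ → Bool
recoverable {q} V ℓ k =
  all (λ x → all (λ x' → not (sameImage V x x') ∨ (toℕ (lookup x k) ≡ᵇ toℕ (lookup x' k)))
                 (allVecs q ℓ))
      (allVecs q ℓ)

R : {q n : ℕ} .{{_ : NonZero q}} → Vec (Fin q) n → ℕ → ℕ
R V ℓ = count (recoverable V ℓ) (allFin ℓ)

-- next(Δ): (A[0..n-1]) ↦ (A[1],…,A[n-1],Δ)   (arrays as ℕ → ℕ on [0,n))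
shift : ℕ → (ℕ → ℕ) → ℕ → (ℕ → ℕ)
shift n A d i = if suc i <ᵇ n then A (suc i) else d

Aafter : {q n : ℕ} → Vec (Fin q) n → ℕ → (ℕ → ℕ)
Aafter Δ zero    = λ _ → 0
Aafter {n = n} Δ (suc s) = shift n (Aafter Δ s) (at Δ s)

answer : {q n : ℕ} .{{_ : NonZero q}} → Vec (Fin q) n → Vec (Fin q) n → ℕ → ℕ
answer {q} {n} V Δ t = Σ< n (λ i → Aafter Δ (suc t) i * at V i) % q

-- Cell-probe model with w-bit cells: 2^w cells (every address fits in a
-- cell), each holding a w-bit word (an element of Fin (2^w)).

Word : ℕ → Set
Word w = Fin (2 ^ w)

Cell : ℕ → Set
Cell w = Fin (2 ^ w)

Mem : ℕ → Set
Mem w = Cell w → Word w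

-- one operation: an adaptive decision tree of cell reads/writes with
-- free computation, ending by returning an element of [q]
data Tree (w q : ℕ) : Set where
  read  : Cell w → (Word w → Tree w q) → Tree w q
  write : Cell w → Word w → Tree w q → Tree w q
  ret   : Fin q → Tree w q

-- an algorithm: initial memory contents and, for each possible input
-- Δ of next(Δ), the decision tree executed. No state besides memory.
record Algo (w q : ℕ) : Set where
  field
    init : Mem w
    op   : Fin q → Tree w q
open Algo public

data Kind : Set where
  R! W! : Kind

record Event (w : ℕ) : Set where
  constructor ev
  field
    time : ℕ
    kind : Kind
    cell : Cell w
open Event public

update : {w : ℕ} → Mem w → Cell w → Word w → Mem w
update m c v c' = if toℕ c' ≡ᵇ toℕ c then v else m c'

runOp : {w q : ℕ} → ℕ → Mem w → Tree w q → Mem w × Fin q × List (Event w)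
runOp {w} t m (read c k) =
  let r = runOp t m (k (m c)) in
  proj₁ r , proj₁ (proj₂ r) , ev {w} t R! c ∷ proj₂ (proj₂ r)
runOp {w} t m (write c v k) =
  let r = runOp t (update {w} m c v) k in
  proj₁ r , proj₁ (proj₂ r) , ev {w} t W! c ∷ proj₂ (proj₂ r)
runOp t m (ret o) = m , o , []

exec : {w q : ℕ} → Algo w q → ℕ → Mem w → List (Fin q) → List (Fin q) × List (Event w)
exec A t m [] = [] , []
exec A t m (d ∷ ds) =
  let r = runOp t m (op A d)
      s = exec A (suc t) (proj₁ r) ds
  in proj₁ (proj₂ r) ∷ proj₁ s , proj₂ (proj₂ r) ++ proj₂ s

toL : {A : Set} {m : ℕ} → Vec A m → List A
toL [] = []
toL (x ∷ xs) = x ∷ toL xs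

run : {w q n : ℕ} → Algo w q → Vec (Fin q) n → List (Fin q) × List (Event w)
run A Δ = exec A 0 (init A) (toL Δ)

Correct : {w q n : ℕ} .{{_ : NonZero q}} → Vec (Fin q) n → Algo w q → Set
Correct {w} {q} {n} V A =
  (Δ : Vec (Fin q) n) → map toℕ (proj₁ (run A Δ)) ≡ map (answer V Δ) (upTo n)

inI : ℕ → ℕ → ℕ → Bool
inI a b x = (a ≤ᵇ x) ∧ (x ≤ᵇ b)

isWriteOf : {w : ℕ} → Cell w → Event w → Bool
isWriteOf c (ev t W! c') = toℕ c ≡ᵇ toℕ c'
isWriteOf c (ev t R! c') = false

isReadOf : {w : ℕ} → Cell w → Event w → Bool
isReadOf c (ev t R! c') = toℕ c ≡ᵇ toℕ c'
isReadOf c (ev t W! c') = false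

-- c is read at some t_r ∈ [t₁+1,t₂] and not written during [t₁+1,t_r]
-- before that read; `pre` = probes preceding the current one
readNotOverwritten : {w : ℕ} → Cell w → ℕ → ℕ → List (Event w) → List (Event w) → Bool
readNotOverwritten c t₁ t₂ pre [] = false
readNotOverwritten c t₁ t₂ pre (e ∷ es) =
  (isReadOf c e ∧ inI (suc t₁) t₂ (time e)
     ∧ not (any (λ e' → isWriteOf c e' ∧ inI (suc t₁) (time e) (time e')) pre))
  ∨ readNotOverwritten c t₁ t₂ (pre ++ (e ∷ [])) es

inIT : {w : ℕ} → ℕ → ℕ → ℕ → List (Event w) → Cell w → Bool
inIT t₀ t₁ t₂ tr c =
  any (λ e → isWriteOf c e ∧ inI t₀ t₁ (time e)) tr ∧ readNotOverwritten c t₁ t₂ [] tr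

ITsize : {w q n : ℕ} → Algo w q → Vec (Fin q) n → ℕ → ℕ → ℕ → ℕ
ITsize {w} A Δ t₀ t₁ t₂ = count (inIT t₀ t₁ t₂ (proj₂ (run A Δ))) (allFin (2 ^ w))

-- Σ_{Δ ∈ [q]^n} |IT(t₀,t₁,t₂)|  (= q^n · E[|IT|] under the uniform distribution)
ITtotal : {w q n : ℕ} → Algo w q → ℕ → ℕ → ℕ → ℕ
ITtotal {w} {q} {n} A t₀ t₁ t₂ = sum (map (λ Δ → ITsize A Δ t₀ t₁ t₂) (allVecs q n))

-- Fix all inputs except those at the recoverable positions k of the window [t₀, t₁]; there are
-- Q = q ^ R such completions. During [t₁ + 1, t₂] the algorithm outputs convolution values, which
-- depend on the window x only through M_{V,ℓ} x and hence determine x at the recoverable positions.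
-- Rerunning the algorithm from its memory at time t₀, patched with the time-(t₁ + 1) contents of
-- the cells in IT(t₀, t₁, t₂), reproduces these outputs, because every other cell it reads before
-- writing is unchanged since t₀. So the list of (cell, content) pairs of IT is an injective code for
-- the Q completions; charging 2w bits per pair plus w bits, Q distinct codes cost at least Q log₂ Q
-- bits in total. Summing over all fixed contexts gives the bound.

module Submission where

open import Defs
open import Data.Bool.Base using (Bool; true; false; _∧_; _∨_; not; if_then_else_; T)
open import Data.Bool.ListAction using (any; all)
open import Data.Bool.Properties using (∧-conicalˡ; ∧-conicalʳ; ∨-zeroʳ; T?; T-∧; T-≡)
open import Data.Empty using (⊥; ⊥-elim)
open import Data.Fin.Base using (Fin; toℕ; zero; suc; fromℕ<)
open import Data.List.Base using (List; []; _∷_; _++_; map; concatMap; length; allFin; filterᵇ; cartesianProduct; take; drop; upTo; applyUpTo)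
import Data.List.Base as List
import Data.List.Properties as Listₚ
open import Data.List.Membership.Propositional using (_∈_)
open import Data.List.Membership.Propositional.Properties
  using (∈-++⁻; ∈-++⁺ˡ; ∈-++⁺ʳ; ∈-map⁺; ∈-map⁻; ∈-allFin; ∈-concat⁺′; ∈-concat⁻′; ∈-∃++; ∈-cartesianProduct⁺)
open import Data.List.Relation.Unary.All as All using (All; []; _∷_)
import Data.List.Relation.Unary.All.Properties as All
open import Data.List.Relation.Unary.Any using (here; there)
open import Data.List.Relation.Unary.AllPairs using ([]; _∷_)
open import Data.List.Relation.Unary.Unique.Propositional using (Unique)
import Data.List.Relation.Unary.Unique.Propositional.Properties as Unique
open import Data.Nat.Base
open import Data.Nat.DivMod using (m≡m%n+[m/n]*n; m%n<n; %-distribˡ-+; [m+kn]%n≡m%n)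
open import Data.Nat.ListAction using (sum)
open import Data.Nat.ListAction.Properties using (sum-++)
open import Data.Nat.Properties
open import Data.Nat.Tactic.RingSolver using (solve-∀)
open import Data.Product.Base using (Σ; _×_; _,_; proj₁; proj₂)
open import Data.Sum.Base using (_⊎_; inj₁; inj₂)
open import Relation.Nullary using (yes; no; ¬_)
open import Data.Vec.Base using (Vec; []; _∷_; tabulate; lookup)
open import Data.Vec.Properties using (∷-injectiveˡ; ∷-injectiveʳ)
import Data.Fin.Properties as Fin
open import Function.Base using (_∘_; id)
open import Function.Bundles using (Equivalence)
open import Relation.Binary.PropositionalEquality

∑ : {A : Set} → List A → (A → ℕ) → ℕ
∑ xs f = sum (map f xs)

module _ {A : Set} where

  ∑-++ : (xs ys : List A) (f : A → ℕ) → ∑ (xs ++ ys) f ≡ ∑ xs f + ∑ ys f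
  ∑-++ xs ys f = trans (cong sum (Listₚ.map-++ f xs ys)) (sum-++ (map f xs) (map f ys))

  ∑-cong : (xs : List A) {f g : A → ℕ} → (∀ x → f x ≡ g x) → ∑ xs f ≡ ∑ xs g
  ∑-cong xs f≗g = cong sum (Listₚ.map-cong f≗g xs)

  ∑-+ : (xs : List A) (f g : A → ℕ) → ∑ xs (λ x → f x + g x) ≡ ∑ xs f + ∑ xs g
  ∑-+ [] f g = refl
  ∑-+ (x ∷ xs) f g = trans (cong (f x + g x +_) (∑-+ xs f g)) (+-interchange (f x) (g x) _ _)
    where
    +-interchange : ∀ a b c d → a + b + (c + d) ≡ a + c + (b + d)
    +-interchange = solve-∀

  *-distribˡ-∑ : (c : ℕ) (xs : List A) (f : A → ℕ) → c * ∑ xs f ≡ ∑ xs (λ x → c * f x)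
  *-distribˡ-∑ c [] f = *-zeroʳ c
  *-distribˡ-∑ c (x ∷ xs) f = trans (*-distribˡ-+ c (f x) _) (cong (c * f x +_) (*-distribˡ-∑ c xs f))

  ∑-const : (xs : List A) (c : ℕ) → ∑ xs (λ _ → c) ≡ length xs * c
  ∑-const [] c = refl
  ∑-const (x ∷ xs) c = cong (c +_) (∑-const xs c)

  ∑-constOn : (xs : List A) (f : A → ℕ) (c : ℕ) → All (λ x → f x ≡ c) xs → ∑ xs f ≡ length xs * c
  ∑-constOn [] f c [] = refl
  ∑-constOn (x ∷ xs) f c (fx≡c ∷ fxs≡c) = cong₂ _+_ fx≡c (∑-constOn xs f c fxs≡c)

  length≡∑1 : (xs : List A) → length xs ≡ ∑ xs (λ _ → 1)
  length≡∑1 xs = trans (sym (*-identityʳ (length xs))) (sym (∑-const xs 1))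

  ^length≤^∑ : (b a : ℕ) (xs : List A) (f : A → ℕ) → (∀ x → a ≤ b ^ f x) → a ^ length xs ≤ b ^ ∑ xs f
  ^length≤^∑ b a [] f a≤ = ≤-refl
  ^length≤^∑ b a (x ∷ xs) f a≤ = begin
    a * a ^ length xs   ≤⟨ *-mono-≤ (a≤ x) (^length≤^∑ b a xs f a≤) ⟩
    b ^ f x * b ^ ∑ xs f ≡⟨ ^-distribˡ-+-* b (f x) _ ⟨
    b ^ (f x + ∑ xs f)  ∎
    where open ≤-Reasoning

∑-map : {A B : Set} (g : A → B) (xs : List A) (f : B → ℕ) → ∑ (map g xs) f ≡ ∑ xs (f ∘ g)
∑-map g xs f = cong sum (sym (Listₚ.map-∘ xs))

∑-concatMap : {A B : Set} (g : A → List B) (xs : List A) (f : B → ℕ) →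
  ∑ (concatMap g xs) f ≡ ∑ xs (λ x → ∑ (g x) f)
∑-concatMap g [] f = refl
∑-concatMap g (x ∷ xs) f = trans (∑-++ (g x) (concatMap g xs) f) (cong (∑ (g x) f +_) (∑-concatMap g xs f))

∑-comm : {A B : Set} (xs : List A) (ys : List B) (g : A → B → ℕ) →
  ∑ xs (λ x → ∑ ys (g x)) ≡ ∑ ys (λ y → ∑ xs (λ x → g x y))
∑-comm [] ys g = sym (trans (∑-const ys 0) (*-zeroʳ (length ys)))
∑-comm (x ∷ xs) ys g = trans (cong (∑ ys (g x) +_) (∑-comm xs ys g)) (sym (∑-+ ys (g x) _))

∈-concatMap⁺ : {A B : Set} (g : A → List B) {x : A} {v : B} {xs : List A} → x ∈ xs → v ∈ g x → v ∈ concatMap g xs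
∈-concatMap⁺ g x∈xs v∈gx = ∈-concat⁺′ v∈gx (∈-map⁺ g x∈xs)

∈-concatMap⁻ : {A B : Set} (g : A → List B) {v : B} (xs : List A) → v ∈ concatMap g xs → Σ A (λ x → x ∈ xs × v ∈ g x)
∈-concatMap⁻ g xs v∈ with ∈-concat⁻′ (map g xs) v∈
... | ys , v∈ys , ys∈ with ∈-map⁻ g ys∈
... | x , x∈xs , refl = x , x∈xs , v∈ys

concatMap⁺ : {A B : Set} (g : A → List B) {xs : List A} → Unique xs → (∀ x → Unique (g x)) →
  (∀ {x y v} → v ∈ g x → v ∈ g y → x ≡ y) → Unique (concatMap g xs)
concatMap⁺ g {[]} _ _ _ = []
concatMap⁺ g {x ∷ xs} (x∉xs ∷ xs!) g! disjoint = Unique.++⁺ (g! x) (concatMap⁺ g xs! g! disjoint) g-disjoint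
  where
  g-disjoint : ∀ {v} → v ∈ g x × v ∈ concatMap g xs → ⊥
  g-disjoint (v∈gx , v∈rest) with ∈-concatMap⁻ g xs v∈rest
  ... | y , y∈xs , v∈gy = Unique.Unique[x∷xs]⇒x∉xs (x∉xs ∷ xs!) (subst (_∈ xs) (disjoint v∈gy v∈gx) y∈xs)

∑-allVecs-suc : (q m : ℕ) (h : Vec (Fin q) (suc m) → ℕ) →
  ∑ (allVecs q (suc m)) h ≡ ∑ (allFin q) (λ d → ∑ (allVecs q m) (λ v → h (d ∷ v)))
∑-allVecs-suc q m h = trans (∑-concatMap _ (allFin q) h) (∑-cong (allFin q) (λ d → ∑-map (d ∷_) (allVecs q m) h))

length-allFin : ∀ q → length (allFin q) ≡ q
length-allFin q = Listₚ.length-tabulate id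

length-allVecs : ∀ q m → length (allVecs q m) ≡ q ^ m
length-allVecs q zero = refl
length-allVecs q (suc m) = begin
  length (allVecs q (suc m))                            ≡⟨ length≡∑1 (allVecs q (suc m)) ⟩
  ∑ (allVecs q (suc m)) (λ _ → 1)                       ≡⟨ ∑-allVecs-suc q m _ ⟩
  ∑ (allFin q) (λ _ → ∑ (allVecs q m) (λ _ → 1))        ≡⟨ ∑-cong (allFin q) (λ _ → trans (sym (length≡∑1 (allVecs q m))) (length-allVecs q m)) ⟩
  ∑ (allFin q) (λ _ → q ^ m)                            ≡⟨ ∑-const (allFin q) _ ⟩
  length (allFin q) * q ^ m                             ≡⟨ cong (_* q ^ m) (length-allFin q) ⟩
  q * q ^ m                                             ∎
  where open ≡-Reasoning

∈-allVecs : ∀ {q m} (v : Vec (Fin q) m) → v ∈ allVecs q m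
∈-allVecs [] = here refl
∈-allVecs (d ∷ v) = ∈-concatMap⁺ _ (∈-allFin d) (∈-map⁺ (d ∷_) (∈-allVecs v))

allVecs-Unique : ∀ q m → Unique (allVecs q m)
allVecs-Unique q zero = [] ∷ []
allVecs-Unique q (suc m) =
  concatMap⁺ _ (Unique.allFin⁺ q) (λ d → Unique.map⁺ ∷-injectiveʳ (allVecs-Unique q m)) same-head
  where
  same-head : ∀ {x y v} → v ∈ map (x ∷_) (allVecs q m) → v ∈ map (y ∷_) (allVecs q m) → x ≡ y
  same-head v∈x v∈y with ∈-map⁻ _ v∈x | ∈-map⁻ _ v∈y
  ... | _ , _ , v≡x∷ | _ , _ , v≡y∷ = ∷-injectiveˡ (trans (sym v≡x∷) v≡y∷)

Unique-⊆⇒length≤ : {A : Set} (xs ys : List A) → Unique xs → (∀ {x} → x ∈ xs → x ∈ ys) → length xs ≤ length ys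
Unique-⊆⇒length≤ [] ys _ _ = z≤n
Unique-⊆⇒length≤ (x ∷ xs) ys (x∉xs ∷ xs!) xs⊆ys with ∈-∃++ (xs⊆ys (here refl))
... | ys₁ , ys₂ , refl = begin
  suc (length xs)                  ≤⟨ s≤s (Unique-⊆⇒length≤ xs (ys₁ ++ ys₂) xs! xs⊆ys₁ys₂) ⟩
  suc (length (ys₁ ++ ys₂))        ≡⟨ cong suc (Listₚ.length-++ ys₁) ⟩
  suc (length ys₁ + length ys₂)    ≡⟨ +-suc (length ys₁) _ ⟨
  length ys₁ + suc (length ys₂)    ≡⟨ Listₚ.length-++ ys₁ ⟨
  length (ys₁ ++ x ∷ ys₂)          ∎
  where
  open ≤-Reasoning
  xs⊆ys₁ys₂ : ∀ {y} → y ∈ xs → y ∈ ys₁ ++ ys₂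
  xs⊆ys₁ys₂ {y} y∈xs with ∈-++⁻ ys₁ (xs⊆ys (there y∈xs))
  ... | inj₁ y∈ys₁ = ∈-++⁺ˡ y∈ys₁
  ... | inj₂ (here refl) = ⊥-elim (All.lookup x∉xs y∈xs refl)
  ... | inj₂ (there y∈ys₂) = ∈-++⁺ʳ ys₁ y∈ys₂

module _ {A : Set} (p : A → Bool) where

  ∑-filterᵇ : (xs : List A) (f : A → ℕ) → ∑ xs f ≡ ∑ (filterᵇ p xs) f + ∑ (filterᵇ (not ∘ p) xs) f
  ∑-filterᵇ [] f = refl
  ∑-filterᵇ (x ∷ xs) f with p x
  ... | true = trans (cong (f x +_) (∑-filterᵇ xs f)) (sym (+-assoc (f x) _ _))
  ... | false = trans (cong (f x +_) (∑-filterᵇ xs f)) (+-comm-middle (f x) (∑ (filterᵇ p xs) f) _)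
    where
    +-comm-middle : ∀ a b c → a + (b + c) ≡ b + (a + c)
    +-comm-middle = solve-∀

  length-filterᵇ-split : (xs : List A) → length xs ≡ length (filterᵇ p xs) + length (filterᵇ (not ∘ p) xs)
  length-filterᵇ-split xs = begin
    length xs                                                              ≡⟨ length≡∑1 xs ⟩
    ∑ xs (λ _ → 1)                                                         ≡⟨ ∑-filterᵇ xs _ ⟩
    ∑ (filterᵇ p xs) (λ _ → 1) + ∑ (filterᵇ (not ∘ p) xs) (λ _ → 1)       ≡⟨ cong₂ _+_ (length≡∑1 (filterᵇ p xs)) (length≡∑1 (filterᵇ (not ∘ p) xs)) ⟨
    length (filterᵇ p xs) + length (filterᵇ (not ∘ p) xs)                  ∎
    where open ≡-Reasoning

  count≡length-filterᵇ : (xs : List A) → count p xs ≡ length (filterᵇ p xs)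
  count≡length-filterᵇ [] = refl
  count≡length-filterᵇ (x ∷ xs) with p x
  ... | true = cong suc (count≡length-filterᵇ xs)
  ... | false = count≡length-filterᵇ xs

T-not⇒¬T : ∀ {b} → T (not b) → ¬ T b
T-not⇒¬T {false} _ ()

≡ᵇ-refl : ∀ n → (n ≡ᵇ n) ≡ true
≡ᵇ-refl zero = refl
≡ᵇ-refl (suc n) = ≡ᵇ-refl n

≡ᵇ⇒≡′ : ∀ {m n} → (m ≡ᵇ n) ≡ true → m ≡ n
≡ᵇ⇒≡′ {m} {n} m≡ᵇn = ≡ᵇ⇒≡ m n (subst T (sym m≡ᵇn) _)

≤⇒≤ᵇ≡true : ∀ {m n} → m ≤ n → (m ≤ᵇ n) ≡ true
≤⇒≤ᵇ≡true m≤n = Equivalence.to T-≡ (≤⇒≤ᵇ m≤n)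

≰⇒≤ᵇ≡false : ∀ {m n} → ¬ m ≤ n → (m ≤ᵇ n) ≡ false
≰⇒≤ᵇ≡false {m} {n} m≰n with m ≤ᵇ n in eq
... | true = ⊥-elim (m≰n (≤ᵇ⇒≤ m n (subst T (sym eq) _)))
... | false = refl

<ᵇ≡true⇒< : ∀ {m n} → (m <ᵇ n) ≡ true → m < n
<ᵇ≡true⇒< {m} {n} eq = <ᵇ⇒< m n (subst T (sym eq) _)

<ᵇ≡false⇒≥ : ∀ {m n} → (m <ᵇ n) ≡ false → n ≤ m
<ᵇ≡false⇒≥ {m} {n} eq = ≮⇒≥ (λ m<n → subst T eq (<⇒<ᵇ m<n))

∨-≡-trueʳ : ∀ a {b} → b ≡ true → (a ∨ b) ≡ true
∨-≡-trueʳ a refl = ∨-zeroʳ a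

∨-monoʳ-≡-true : ∀ a {b b′} → (b ≡ true → b′ ≡ true) → (a ∨ b) ≡ true → (a ∨ b′) ≡ true
∨-monoʳ-≡-true true _ _ = refl
∨-monoʳ-≡-true false b⇒b′ = b⇒b′

∧-≡-false⇒≡-false : ∀ {a b} → (a ∧ b) ≡ false → b ≡ true → a ≡ false
∧-≡-false⇒≡-false {false} _ _ = refl
∧-≡-false⇒≡-false {true} a∧b≡false refl = a∧b≡false

not-≡-true : ∀ {b} → not b ≡ true → b ≡ false
not-≡-true {false} _ = refl

module _ {A : Set} (p : A → Bool) where

  any-≡-false⁺ : (xs : List A) → All (λ x → p x ≡ false) xs → any p xs ≡ false
  any-≡-false⁺ [] [] = refl
  any-≡-false⁺ (x ∷ xs) (px≡false ∷ pxs) rewrite px≡false = any-≡-false⁺ xs pxs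

  any-≡-false⁻ : (xs : List A) → any p xs ≡ false → All (λ x → p x ≡ false) xs
  any-≡-false⁻ [] _ = []
  any-≡-false⁻ (x ∷ xs) any≡false with p x in px
  ... | false = px ∷ any-≡-false⁻ xs any≡false

  all-≡-true⁻ : (xs : List A) {x : A} → all p xs ≡ true → x ∈ xs → p x ≡ true
  all-≡-true⁻ (y ∷ xs) all≡true (here refl) = ∧-conicalˡ _ _ all≡true
  all-≡-true⁻ (y ∷ xs) all≡true (there x∈) = all-≡-true⁻ xs (∧-conicalʳ _ _ all≡true) x∈

all-upTo : ∀ (p : ℕ → Bool) m → (∀ i → i < m → p i ≡ true) → all p (upTo m) ≡ true
all-upTo p m p-true = go id m p-true
  where
  go : ∀ (g : ℕ → ℕ) m → (∀ i → i < m → p (g i) ≡ true) → all p (applyUpTo g m) ≡ true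
  go g zero _ = refl
  go g (suc m) p-true rewrite p-true 0 (s≤s z≤n) = go (g ∘ suc) m (λ i i<m → p-true (suc i) (s≤s i<m))

module _ {A : Set} (al : List A) where

  listsOfLength : ℕ → List (List A)
  listsOfLength zero = [] ∷ []
  listsOfLength (suc i) = concatMap (λ a → map (a ∷_) (listsOfLength i)) al

  listsUpTo : ℕ → List (List A)
  listsUpTo zero = listsOfLength 0
  listsUpTo (suc K) = listsUpTo K ++ listsOfLength (suc K)

  length-listsOfLength : ∀ i → length (listsOfLength i) ≡ length al ^ i
  length-listsOfLength zero = refl
  length-listsOfLength (suc i) = begin
    length (listsOfLength (suc i))                          ≡⟨ length≡∑1 (listsOfLength (suc i)) ⟩
    ∑ (listsOfLength (suc i)) (λ _ → 1)                     ≡⟨ ∑-concatMap _ al _ ⟩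
    ∑ al (λ a → ∑ (map (a ∷_) (listsOfLength i)) (λ _ → 1)) ≡⟨ ∑-cong al length-layer ⟩
    ∑ al (λ _ → length al ^ i)                              ≡⟨ ∑-const al _ ⟩
    length al * length al ^ i                               ∎
    where
    open ≡-Reasoning
    length-layer : ∀ a → ∑ (map (a ∷_) (listsOfLength i)) (λ _ → 1) ≡ length al ^ i
    length-layer a = trans (∑-map (a ∷_) (listsOfLength i) _)
                           (trans (sym (length≡∑1 (listsOfLength i))) (length-listsOfLength i))

  module _ (complete : ∀ a → a ∈ al) where

    ∈-listsOfLength : (xs : List A) → xs ∈ listsOfLength (length xs)
    ∈-listsOfLength [] = here refl
    ∈-listsOfLength (x ∷ xs) = ∈-concatMap⁺ _ (complete x) (∈-map⁺ (x ∷_) (∈-listsOfLength xs))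

    ∈-listsUpTo : ∀ K (xs : List A) → length xs ≤ K → xs ∈ listsUpTo K
    ∈-listsUpTo zero [] z≤n = here refl
    ∈-listsUpTo (suc K) xs ∣xs∣≤ with m≤n⇒m<n∨m≡n ∣xs∣≤
    ... | inj₁ (s≤s ∣xs∣≤K) = ∈-++⁺ˡ (∈-listsUpTo K xs ∣xs∣≤K)
    ... | inj₂ ∣xs∣≡ = ∈-++⁺ʳ (listsUpTo K) (subst (λ i → xs ∈ listsOfLength i) ∣xs∣≡ (∈-listsOfLength xs))

geomSum : ℕ → ℕ → ℕ
geomSum B zero = 1
geomSum B (suc K) = geomSum B K + B ^ suc K

length-listsUpTo : {A : Set} (al : List A) (K : ℕ) → length (listsUpTo al K) ≡ geomSum (length al) K
length-listsUpTo al zero = refl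
length-listsUpTo al (suc K) =
  trans (Listₚ.length-++ (listsUpTo al K)) (cong₂ _+_ (length-listsUpTo al K) (length-listsOfLength al (suc K)))

Unique-short-lists-bound : {A : Set} (al : List A) → (∀ a → a ∈ al) → ∀ K (cs : List (List A)) →
  Unique cs → All (λ c → length c ≤ K) cs → length cs ≤ geomSum (length al) K
Unique-short-lists-bound al complete K cs cs! short = begin
  length cs                  ≤⟨ Unique-⊆⇒length≤ cs (listsUpTo al K) cs! (λ {c} c∈ → ∈-listsUpTo al complete K c (All.lookup short c∈)) ⟩
  length (listsUpTo al K)    ≡⟨ length-listsUpTo al K ⟩
  geomSum (length al) K      ∎
  where open ≤-Reasoning

length-cartesianProduct : {A B : Set} (xs : List A) (ys : List B) → length (cartesianProduct xs ys) ≡ length xs * length ys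
length-cartesianProduct [] ys = refl
length-cartesianProduct (x ∷ xs) ys =
  trans (Listₚ.length-++ (map (x ,_) ys)) (cong₂ _+_ (Listₚ.length-map (x ,_) ys) (length-cartesianProduct xs ys))

-- Total length of distinct codes

geomSum-≥ : ∀ B → 1 ≤ B → ∀ K → suc K ≤ geomSum B K
geomSum-≥ B 1≤B zero = ≤-refl
geomSum-≥ B 1≤B (suc K) = begin
  suc (suc K)            ≡⟨ +-comm 1 (suc K) ⟩
  suc K + 1              ≤⟨ +-mono-≤ (geomSum-≥ B 1≤B K) (subst (_≤ B ^ suc K) (^-zeroˡ (suc K)) (^-monoˡ-≤ (suc K) 1≤B)) ⟩
  geomSum B K + B ^ suc K ∎
  where open ≤-Reasoning

geomSum-*-pred : ∀ B → 1 ≤ B → ∀ K → geomSum B K * (B ∸ 1) ≤ B ^ suc K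
geomSum-*-pred B 1≤B zero = subst₂ _≤_ (sym (+-identityʳ (B ∸ 1))) (sym (*-identityʳ B)) (m∸n≤m B 1)
geomSum-*-pred B 1≤B (suc K) = begin
  (geomSum B K + B ^ suc K) * (B ∸ 1)               ≡⟨ *-distribʳ-+ (B ∸ 1) (geomSum B K) _ ⟩
  geomSum B K * (B ∸ 1) + B ^ suc K * (B ∸ 1)       ≤⟨ +-monoˡ-≤ _ (geomSum-*-pred B 1≤B K) ⟩
  B ^ suc K + B ^ suc K * (B ∸ 1)                   ≡⟨ cong (_+ B ^ suc K * (B ∸ 1)) (*-identityʳ (B ^ suc K)) ⟨
  B ^ suc K * 1 + B ^ suc K * (B ∸ 1)               ≡⟨ *-distribˡ-+ (B ^ suc K) 1 (B ∸ 1) ⟨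
  B ^ suc K * (1 + (B ∸ 1))                         ≡⟨ cong (B ^ suc K *_) (m+[n∸m]≡n 1≤B) ⟩
  B ^ suc K * B                                     ≡⟨ *-comm (B ^ suc K) B ⟩
  B ^ suc (suc K)                                   ∎
  where open ≤-Reasoning

leastCoverFrom : ℕ → ℕ → ℕ → ℕ → ℕ
leastCoverFrom B zero m K = K
leastCoverFrom B (suc fuel) m K with m ≤? geomSum B K
... | yes _ = K
... | no _ = leastCoverFrom B fuel m (suc K)

-- The least K with m ≤ geomSum B K; by geomSum-≥ the search needs at most m steps.
leastCover : ℕ → ℕ → ℕ
leastCover B m = leastCoverFrom B m m 0

leastCover-minimal : ∀ B m K → m ≤ geomSum B K → leastCover B m ≤ K
leastCover-minimal B m K m≤ = go m 0 z≤n
  where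
  go : ∀ fuel K₀ → K₀ ≤ K → leastCoverFrom B fuel m K₀ ≤ K
  go zero K₀ K₀≤K = K₀≤K
  go (suc fuel) K₀ K₀≤K with m ≤? geomSum B K₀
  ... | yes _ = K₀≤K
  ... | no m≰ = go fuel (suc K₀) (≤∧≢⇒< K₀≤K (λ K₀≡K → m≰ (subst (λ z → m ≤ geomSum B z) (sym K₀≡K) m≤)))

leastCover-covers : ∀ B → 1 ≤ B → ∀ m → m ≤ geomSum B (leastCover B m)
leastCover-covers B 1≤B m = go m 0 (≤-trans (n≤1+n m) (geomSum-≥ B 1≤B m))
  where
  go : ∀ fuel K₀ → m ≤ geomSum B (K₀ + fuel) → m ≤ geomSum B (leastCoverFrom B fuel m K₀)
  go zero K₀ m≤ = subst (λ z → m ≤ geomSum B z) (+-identityʳ K₀) m≤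
  go (suc fuel) K₀ m≤ with m ≤? geomSum B K₀
  ... | yes m≤′ = m≤′
  ... | no _ = go fuel (suc K₀) (subst (λ z → m ≤ geomSum B z) (+-suc K₀ fuel) m≤)

-- A code of k pairs of w-bit words is charged 2wk + w bits.
codeBits : ℕ → ℕ → ℕ
codeBits w k = 2 * w * k + w

codeBits-mono : ∀ w {k k′} → k ≤ k′ → codeBits w k ≤ codeBits w k′
codeBits-mono w k≤k′ = +-monoˡ-≤ w (*-monoʳ-≤ (2 * w) k≤k′)

-- Over an alphabet of size B, at most geomSum B K distinct codes have length ≤ K, so the i-th
-- shortest of m distinct codes has length ≥ leastCover B i; greedyCost is the resulting lower bound.
greedyCost : ℕ → ℕ → ℕ → ℕ
greedyCost B w zero = 1
greedyCost B w (suc m) = greedyCost B w m * 2 ^ codeBits w (leastCover B (suc m))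

greedyCost-+ : ∀ B w K a b → b + a ≤ geomSum B K → greedyCost B w (b + a) ≤ greedyCost B w b * 2 ^ (a * codeBits w K)
greedyCost-+ B w K zero b _ =
  subst (λ z → greedyCost B w z ≤ greedyCost B w b * 1) (sym (+-identityʳ b)) (≤-reflexive (sym (*-identityʳ _)))
greedyCost-+ B w K (suc a) b b+a≤geom = begin
  greedyCost B w (b + suc a)                                   ≡⟨ cong (greedyCost B w) (+-suc b a) ⟩
  greedyCost B w (b + a) * 2 ^ codeBits w (leastCover B (suc (b + a)))
    ≤⟨ *-mono-≤ (greedyCost-+ B w K a b (≤-trans (+-monoʳ-≤ b (n≤1+n a)) b+a≤geom))
                (^-monoʳ-≤ 2 (codeBits-mono w (leastCover-minimal B (suc (b + a)) K (subst (_≤ geomSum B K) (+-suc b a) b+a≤geom)))) ⟩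
  greedyCost B w b * 2 ^ (a * codeBits w K) * 2 ^ codeBits w K  ≡⟨ *-assoc (greedyCost B w b) _ _ ⟩
  greedyCost B w b * (2 ^ (a * codeBits w K) * 2 ^ codeBits w K) ≡⟨ cong (greedyCost B w b *_) (^-distribˡ-+-* 2 (a * codeBits w K) (codeBits w K)) ⟨
  greedyCost B w b * 2 ^ (a * codeBits w K + codeBits w K)     ≡⟨ cong (λ z → greedyCost B w b * 2 ^ z) (+-comm (a * codeBits w K) _) ⟩
  greedyCost B w b * 2 ^ (suc a * codeBits w K)                 ∎
  where open ≤-Reasoning

greedyCost≤2^∑codeBits : ∀ w {A : Set} (al : List A) → (∀ a → a ∈ al) → ∀ K (cs : List (List A)) →
  Unique cs → All (λ c → length c < K) cs → greedyCost (length al) w (length cs) ≤ 2 ^ ∑ cs (codeBits w ∘ length)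
greedyCost≤2^∑codeBits w al complete zero [] _ _ = ≤-refl
greedyCost≤2^∑codeBits w al complete zero (c ∷ cs) _ (() ∷ _)
greedyCost≤2^∑codeBits w al complete (suc K) cs cs! short = begin
  greedyCost B w (length cs)                                ≡⟨ cong (greedyCost B w) (length-filterᵇ-split shorter cs) ⟩
  greedyCost B w (length sh + length lo)                    ≤⟨ greedyCost-+ B w K (length lo) (length sh) sh+lo≤ ⟩
  greedyCost B w (length sh) * 2 ^ (length lo * codeBits w K)
    ≤⟨ *-monoˡ-≤ _ (greedyCost≤2^∑codeBits w al complete K sh (Unique.filter⁺ (T? ∘ shorter) cs!) sh-short) ⟩
  2 ^ ∑ sh bits * 2 ^ (length lo * codeBits w K)            ≡⟨ cong (λ z → 2 ^ ∑ sh bits * 2 ^ z) (∑-constOn lo bits (codeBits w K) lo-bits) ⟨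
  2 ^ ∑ sh bits * 2 ^ ∑ lo bits                             ≡⟨ ^-distribˡ-+-* 2 (∑ sh bits) (∑ lo bits) ⟨
  2 ^ (∑ sh bits + ∑ lo bits)                               ≡⟨ cong (2 ^_) (∑-filterᵇ shorter cs bits) ⟨
  2 ^ ∑ cs bits                                             ∎
  where
  open ≤-Reasoning
  B = length al
  bits : List _ → ℕ
  bits = codeBits w ∘ length
  shorter : List _ → Bool
  shorter c = length c <ᵇ K
  sh = filterᵇ shorter cs
  lo = filterᵇ (not ∘ shorter) cs
  sh+lo≤ : length sh + length lo ≤ geomSum B K
  sh+lo≤ = subst (_≤ geomSum B K) (length-filterᵇ-split shorter cs)
             (Unique-short-lists-bound al complete K cs cs! (All.map ≤-pred short))
  sh-short : All (λ c → length c < K) sh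
  sh-short = All.map (λ {c} → <ᵇ⇒< (length c) K) (All.all-filter (T? ∘ shorter) cs)
  lo-bits : All (λ c → bits c ≡ codeBits w K) lo
  lo-bits = All.zipWith (λ { {c} (c≮K , c<1+K) → cong (codeBits w) (≤-antisym (≤-pred c<1+K) (≮⇒≥ (T-not⇒¬T c≮K ∘ <⇒<ᵇ))) })
              (All.all-filter (T? ∘ (not ∘ shorter)) cs , All.filter⁺ (T? ∘ (not ∘ shorter)) short)

^-distribʳ-* : ∀ x y n → (x * y) ^ n ≡ x ^ n * y ^ n
^-distribʳ-* x y zero = refl
^-distribʳ-* x y (suc n) = trans (cong (x * y *_) (^-distribʳ-* x y n)) (*-interchange x y (x ^ n) (y ^ n))
  where
  *-interchange : ∀ a b c d → a * b * (c * d) ≡ a * c * (b * d)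
  *-interchange = solve-∀

^-swap : ∀ x a b → (x ^ a) ^ b ≡ (x ^ b) ^ a
^-swap x a b = trans (^-*-assoc x a b) (trans (cong (x ^_) (*-comm a b)) (sym (^-*-assoc x b a)))

-- ((b + 1) / b) ^ Q ≤ b / (b − Q), with the denominators cleared.
[1+b]^Q*[b∸Q]≤b^[1+Q] : ∀ b Q → suc b ^ Q * (b ∸ Q) ≤ b ^ suc Q
[1+b]^Q*[b∸Q]≤b^[1+Q] b zero = ≤-reflexive (trans (+-identityʳ b) (sym (*-identityʳ b)))
[1+b]^Q*[b∸Q]≤b^[1+Q] b (suc Q) = begin
  suc b * suc b ^ Q * (b ∸ suc Q)   ≡⟨ rearrange (suc b) (suc b ^ Q) (b ∸ suc Q) ⟩
  suc b ^ Q * (suc b * (b ∸ suc Q)) ≤⟨ *-monoʳ-≤ (suc b ^ Q) step ⟩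
  suc b ^ Q * (b * (b ∸ Q))         ≡⟨ *-comm-middle (suc b ^ Q) b (b ∸ Q) ⟩
  b * (suc b ^ Q * (b ∸ Q))         ≤⟨ *-monoʳ-≤ b ([1+b]^Q*[b∸Q]≤b^[1+Q] b Q) ⟩
  b * b ^ suc Q                     ∎
  where
  open ≤-Reasoning
  rearrange : ∀ x y z → x * y * z ≡ y * (x * z)
  rearrange = solve-∀
  *-comm-middle : ∀ x y z → x * (y * z) ≡ y * (x * z)
  *-comm-middle = solve-∀
  step : suc b * (b ∸ suc Q) ≤ b * (b ∸ Q)
  step with b ≤? Q
  ... | yes b≤Q rewrite m≤n⇒m∸n≡0 (≤-trans b≤Q (n≤1+n Q)) | *-zeroʳ (suc b) = z≤n
  ... | no b≰Q = begin
    suc b * (b ∸ suc Q)           ≤⟨ +-monoˡ-≤ (b * (b ∸ suc Q)) (m∸n≤m b (suc Q)) ⟩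
    b + b * (b ∸ suc Q)           ≡⟨ *-suc b (b ∸ suc Q) ⟨
    b * suc (b ∸ suc Q)           ≡⟨ cong (b *_) (+-∸-assoc 1 (≰⇒> b≰Q)) ⟨
    b * (b ∸ Q)                   ∎

2*[1+3Q]^Q≤3*[3Q]^Q : ∀ Q → 1 ≤ Q → 2 * suc (3 * Q) ^ Q ≤ 3 * (3 * Q) ^ Q
2*[1+3Q]^Q≤3*[3Q]^Q Q@(suc _) _ = *-cancelʳ-≤ _ _ Q (subst₂ _≤_ lhs rhs ([1+b]^Q*[b∸Q]≤b^[1+Q] (3 * Q) Q))
  where
  3Q∸Q : 3 * Q ∸ Q ≡ 2 * Q
  3Q∸Q = trans (cong (_∸ Q) (3z≡2z+z Q)) (m+n∸n≡m (2 * Q) Q)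
    where
    3z≡2z+z : ∀ z → 3 * z ≡ 2 * z + z
    3z≡2z+z = solve-∀
  lhs : suc (3 * Q) ^ Q * (3 * Q ∸ Q) ≡ 2 * suc (3 * Q) ^ Q * Q
  lhs = trans (cong (suc (3 * Q) ^ Q *_) 3Q∸Q) (shuffle (suc (3 * Q) ^ Q) Q)
    where
    shuffle : ∀ x z → x * (2 * z) ≡ 2 * x * z
    shuffle = solve-∀
  rhs : (3 * Q) ^ suc Q ≡ 3 * (3 * Q) ^ Q * Q
  rhs = shuffle ((3 * Q) ^ Q) Q
    where
    shuffle : ∀ y z → 3 * z * y ≡ 3 * y * z
    shuffle = solve-∀

[1+Q]*[3Q]^3≤Q*[1+3Q]^3 : ∀ Q → suc Q * (3 * Q) ^ 3 ≤ Q * suc (3 * Q) ^ 3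
[1+Q]*[3Q]^3≤Q*[1+3Q]^3 Q = subst₂ _≤_ (sym (lhs Q)) (sym (rhs Q)) (m≤m+n _ (9 * (Q * Q) + Q))
  where
  lhs : ∀ z → (1 + z) * ((3 * z) * ((3 * z) * ((3 * z) * 1))) ≡ (z + 1) * ((3 * z) * ((3 * z) * (3 * z)))
  lhs = solve-∀
  rhs : ∀ z → z * ((1 + 3 * z) * ((1 + 3 * z) * ((1 + 3 * z) * 1))) ≡ (z + 1) * ((3 * z) * ((3 * z) * (3 * z))) + (9 * (z * z) + z)
  rhs = solve-∀

-- (1 + 1/Q)^Q ≤ (1 + 1/(3Q))^(3Q) ≤ (3/2)^3: the first step is the cube root of
-- [1+Q]*[3Q]^3≤Q*[1+3Q]^3 raised to the Q, the second is 2*[1+3Q]^Q≤3*[3Q]^Q cubed.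
8*[1+Q]^Q≤27*Q^Q : ∀ Q → 8 * suc Q ^ Q ≤ 27 * Q ^ Q
8*[1+Q]^Q≤27*Q^Q zero = s≤s (s≤s (s≤s (s≤s (s≤s (s≤s (s≤s (s≤s z≤n)))))))
8*[1+Q]^Q≤27*Q^Q Q@(suc _) = *-cancelʳ-≤ (8 * suc Q ^ Q) (27 * Q ^ Q) Z {{m^n≢0 _ Q}} (begin
  8 * suc Q ^ Q * Z    ≡⟨ *-assoc 8 (suc Q ^ Q) Z ⟩
  8 * (suc Q ^ Q * Z)  ≤⟨ *-monoʳ-≤ 8 first ⟩
  8 * (Q ^ Q * C)      ≡⟨ *-comm-middle 8 (Q ^ Q) C ⟩
  Q ^ Q * (8 * C)      ≤⟨ *-monoʳ-≤ (Q ^ Q) second ⟩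
  Q ^ Q * (27 * Z)     ≡⟨ *-comm-middle (Q ^ Q) 27 Z ⟩
  27 * (Q ^ Q * Z)     ≡⟨ *-assoc 27 (Q ^ Q) Z ⟨
  27 * Q ^ Q * Z       ∎)
  where
  open ≤-Reasoning
  Z = ((3 * Q) ^ 3) ^ Q
  C = (suc (3 * Q) ^ 3) ^ Q
  *-comm-middle : ∀ x y z → x * (y * z) ≡ y * (x * z)
  *-comm-middle = solve-∀
  first : suc Q ^ Q * Z ≤ Q ^ Q * C
  first = subst₂ _≤_ (^-distribʳ-* (suc Q) ((3 * Q) ^ 3) Q) (^-distribʳ-* Q (suc (3 * Q) ^ 3) Q)
            (^-monoˡ-≤ Q ([1+Q]*[3Q]^3≤Q*[1+3Q]^3 Q))
  second : 8 * C ≤ 27 * Z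
  second = subst₂ _≤_ (trans (^-distribʳ-* 2 (suc (3 * Q) ^ Q) 3) (cong (8 *_) (^-swap (suc (3 * Q)) Q 3)))
                      (trans (^-distribʳ-* 3 ((3 * Q) ^ Q) 3) (cong (27 *_) (^-swap (3 * Q) Q 3)))
                      (^-monoˡ-≤ 3 (2*[1+3Q]^Q≤3*[3Q]^Q Q (s≤s z≤n)))

27*u≤8*[u*u∸1] : ∀ u → 4 ≤ u → 27 * u ≤ 8 * (u * u ∸ 1)
27*u≤8*[u*u∸1] u 4≤u with m≤n⇒∃[o]m+o≡n 4≤u
... | v , refl = subst (27 * (4 + v) ≤_) (sym expand) (m≤m+n (27 * (4 + v)) (12 + 37 * v + 8 * (v * v)))
  where
  square : ∀ v → (4 + v) * (4 + v) ≡ 1 + (15 + 8 * v + v * v)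
  square = solve-∀
  split : ∀ v → 8 * (15 + 8 * v + v * v) ≡ 27 * (4 + v) + (12 + 37 * v + 8 * (v * v))
  split = solve-∀
  expand : 8 * ((4 + v) * (4 + v) ∸ 1) ≡ 27 * (4 + v) + (12 + 37 * v + 8 * (v * v))
  expand = trans (cong (λ z → 8 * (z ∸ 1)) (square v)) (split v)

2^codeBits : ∀ w k → 2 ^ codeBits w k ≡ 2 ^ w * (2 ^ w * 2 ^ w) ^ k
2^codeBits w k = begin
  2 ^ (2 * w * k + w)            ≡⟨ ^-distribˡ-+-* 2 (2 * w * k) w ⟩
  2 ^ (2 * w * k) * 2 ^ w        ≡⟨ cong (_* 2 ^ w) (^-*-assoc 2 (2 * w) k) ⟨
  (2 ^ (2 * w)) ^ k * 2 ^ w      ≡⟨ cong (λ z → (2 ^ z) ^ k * 2 ^ w) (cong (w +_) (+-identityʳ w)) ⟩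
  (2 ^ (w + w)) ^ k * 2 ^ w      ≡⟨ cong (λ z → z ^ k * 2 ^ w) (^-distribˡ-+-* 2 w w) ⟩
  (2 ^ w * 2 ^ w) ^ k * 2 ^ w    ≡⟨ *-comm _ (2 ^ w) ⟩
  2 ^ w * (2 ^ w * 2 ^ w) ^ k    ∎
  where open ≡-Reasoning

-- m ≤ geomSum B G ≤ B^(G+1)/(B − 1) with B = u², and 27 B ≤ 8 u (B − 1) once u ≥ 4.
27*m≤8*2^codeBits : ∀ w → 2 ≤ w → ∀ m → 27 * m ≤ 8 * 2 ^ codeBits w (leastCover (2 ^ w * 2 ^ w) m)
27*m≤8*2^codeBits w 2≤w m = *-cancelʳ-≤ (27 * m) (8 * 2 ^ codeBits w G) (B ∸ 1) {{>-nonZero 0<B∸1}} (begin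
  27 * m * (B ∸ 1)                  ≤⟨ *-monoˡ-≤ (B ∸ 1) (*-monoʳ-≤ 27 (leastCover-covers B 1≤B m)) ⟩
  27 * geomSum B G * (B ∸ 1)        ≡⟨ *-assoc 27 (geomSum B G) (B ∸ 1) ⟩
  27 * (geomSum B G * (B ∸ 1))      ≤⟨ *-monoʳ-≤ 27 (geomSum-*-pred B 1≤B G) ⟩
  27 * (B * B ^ G)                  ≡⟨ regroup u (B ^ G) ⟩
  27 * u * (u * B ^ G)              ≤⟨ *-monoˡ-≤ (u * B ^ G) (27*u≤8*[u*u∸1] u 4≤u) ⟩
  8 * (B ∸ 1) * (u * B ^ G)         ≡⟨ swap (B ∸ 1) (u * B ^ G) ⟩
  8 * (u * B ^ G) * (B ∸ 1)         ≡⟨ cong (λ z → 8 * z * (B ∸ 1)) (2^codeBits w G) ⟨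
  8 * 2 ^ codeBits w G * (B ∸ 1)    ∎)
  where
  open ≤-Reasoning
  u = 2 ^ w
  B = u * u
  G = leastCover B m
  4≤u : 4 ≤ u
  4≤u = ^-monoʳ-≤ 2 2≤w
  1≤B : 1 ≤ B
  1≤B = *-mono-≤ (≤-trans (s≤s z≤n) 4≤u) (≤-trans (s≤s z≤n) 4≤u)
  0<B∸1 : 0 < B ∸ 1
  0<B∸1 = ≤-trans (s≤s z≤n) (∸-monoˡ-≤ 1 (*-mono-≤ 4≤u 4≤u))
  regroup : ∀ x y → 27 * (x * x * y) ≡ 27 * x * (x * y)
  regroup = solve-∀
  swap : ∀ x y → 8 * x * y ≡ 8 * y * x
  swap = solve-∀

-- Induction on Q: (Q + 1)^(Q + 1) / Q^Q = (Q + 1)(1 + 1/Q)^Q ≤ 27 (Q + 1) / 8.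
Q^Q≤greedyCost : ∀ w → 2 ≤ w → ∀ Q → Q ^ Q ≤ greedyCost (2 ^ w * 2 ^ w) w Q
Q^Q≤greedyCost w 2≤w zero = ≤-refl
Q^Q≤greedyCost w 2≤w (suc Q) = *-cancelˡ-≤ 8 (begin
  8 * (suc Q * suc Q ^ Q)           ≡⟨ *-comm-middle 8 (suc Q) (suc Q ^ Q) ⟩
  suc Q * (8 * suc Q ^ Q)           ≤⟨ *-monoʳ-≤ (suc Q) (8*[1+Q]^Q≤27*Q^Q Q) ⟩
  suc Q * (27 * Q ^ Q)              ≡⟨ regroup (suc Q) (Q ^ Q) ⟩
  27 * suc Q * Q ^ Q                ≤⟨ *-mono-≤ (27*m≤8*2^codeBits w 2≤w (suc Q)) (Q^Q≤greedyCost w 2≤w Q) ⟩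
  8 * P * greedyCost B w Q          ≡⟨ swap P (greedyCost B w Q) ⟩
  8 * (greedyCost B w Q * P)        ∎)
  where
  open ≤-Reasoning
  B = 2 ^ w * 2 ^ w
  P = 2 ^ codeBits w (leastCover B (suc Q))
  *-comm-middle : ∀ x y z → x * (y * z) ≡ y * (x * z)
  *-comm-middle = solve-∀
  regroup : ∀ x y → x * (27 * y) ≡ 27 * x * y
  regroup = solve-∀
  swap : ∀ x y → 8 * x * y ≡ 8 * (y * x)
  swap = solve-∀

-- For w = 1 at most geomSum 4 2 = 21 codes exist, and the bound is checked for each count.
Q^Q≤greedyCost-w=1 : ∀ Q → Q ≤ 21 → Q ^ Q ≤ greedyCost (2 ^ 1 * 2 ^ 1) 1 Q
Q^Q≤greedyCost-w=1 Q Q≤21 = ≤ᵇ⇒≤ _ _ (checkUpTo-sound 21 checkUpTo-21 Q Q≤21)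
  where
  check : ℕ → Bool
  check Q = Q ^ Q ≤ᵇ greedyCost 4 1 Q
  checkUpTo : ℕ → Bool
  checkUpTo zero = check 0
  checkUpTo (suc k) = check (suc k) ∧ checkUpTo k
  checkUpTo-21 : T (checkUpTo 21)
  checkUpTo-21 = _
  checkUpTo-sound : ∀ k → T (checkUpTo k) → ∀ Q → Q ≤ k → T (check Q)
  checkUpTo-sound zero ok zero z≤n = ok
  checkUpTo-sound (suc k) ok Q Q≤1+k with m≤n⇒m<n∨m≡n Q≤1+k
  ... | inj₁ (s≤s Q≤k) = checkUpTo-sound k (proj₂ (Equivalence.to T-∧ ok)) Q Q≤k
  ... | inj₂ refl = proj₁ (Equivalence.to T-∧ ok)

module _ (w : ℕ) where

  pairs : List (Cell w × Word w)
  pairs = cartesianProduct (allFin (2 ^ w)) (allFin (2 ^ w))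

  ∈-pairs : ∀ p → p ∈ pairs
  ∈-pairs (c , v) = ∈-cartesianProduct⁺ (∈-allFin c) (∈-allFin v)

  length-pairs : length pairs ≡ 2 ^ w * 2 ^ w
  length-pairs = trans (length-cartesianProduct (allFin (2 ^ w)) (allFin (2 ^ w))) (cong₂ _*_ (length-allFin (2 ^ w)) (length-allFin (2 ^ w)))

  Unique-codes-bits : 1 ≤ w → (cs : List (List (Cell w × Word w))) → Unique cs →
    All (λ c → length c ≤ 2 ^ w) cs → length cs ^ length cs ≤ 2 ^ ∑ cs (codeBits w ∘ length)
  Unique-codes-bits 1≤w cs cs! short = begin
    length cs ^ length cs                      ≤⟨ power≤greedy w 1≤w refl ⟩
    greedyCost (2 ^ w * 2 ^ w) w (length cs)   ≡⟨ cong (λ B → greedyCost B w (length cs)) length-pairs ⟨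
    greedyCost (length pairs) w (length cs)    ≤⟨ greedyCost≤2^∑codeBits w pairs ∈-pairs (suc (2 ^ w)) cs cs! (All.map s≤s short) ⟩
    2 ^ ∑ cs (codeBits w ∘ length)             ∎
    where
    open ≤-Reasoning
    power≤greedy : ∀ w′ → 1 ≤ w′ → w′ ≡ w → length cs ^ length cs ≤ greedyCost (2 ^ w * 2 ^ w) w (length cs)
    power≤greedy (suc (suc _)) _ refl = Q^Q≤greedyCost w (s≤s (s≤s z≤n)) (length cs)
    power≤greedy 1 _ refl = Q^Q≤greedyCost-w=1 (length cs)
      (subst (λ B → length cs ≤ geomSum B 2) length-pairs (Unique-short-lists-bound pairs ∈-pairs 2 cs cs! short))

selected : ∀ {m} → Vec Bool m → ℕ
selected [] = 0
selected (true ∷ S) = suc (selected S)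
selected (false ∷ S) = selected S

selects : ∀ {m} → Vec Bool m → ℕ → Bool
selects [] _ = false
selects (b ∷ S) zero = b
selects (b ∷ S) (suc i) = selects S i

overwrite : {A : Set} {m : ℕ} (S : Vec Bool m) → Vec A m → Vec A (selected S) → Vec A m
overwrite [] [] [] = []
overwrite (true ∷ S) (_ ∷ Δ) (r ∷ rs) = r ∷ overwrite S Δ rs
overwrite (false ∷ S) (d ∷ Δ) rs = d ∷ overwrite S Δ rs

module _ {q : ℕ} where

  overwrite-unselected : ∀ {m} (S : Vec Bool m) (Δ : Vec (Fin q) m) r i → selects S i ≡ false → at (overwrite S Δ r) i ≡ at Δ i
  overwrite-unselected [] [] [] i _ = refl
  overwrite-unselected (true ∷ S) (d ∷ Δ) (r ∷ rs) (suc i) Si = overwrite-unselected S Δ rs i Si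
  overwrite-unselected (false ∷ S) (d ∷ Δ) rs zero _ = refl
  overwrite-unselected (false ∷ S) (d ∷ Δ) rs (suc i) Si = overwrite-unselected S Δ rs i Si

  overwrite-injective : ∀ {m} (S : Vec Bool m) (Δ : Vec (Fin q) m) r r′ →
    (∀ i → selects S i ≡ true → at (overwrite S Δ r) i ≡ at (overwrite S Δ r′) i) → r ≡ r′
  overwrite-injective [] [] [] [] _ = refl
  overwrite-injective (true ∷ S) (d ∷ Δ) (r ∷ rs) (r′ ∷ rs′) agree =
    cong₂ _∷_ (Fin.toℕ-injective (agree 0 refl)) (overwrite-injective S Δ rs rs′ (agree ∘ suc))
  overwrite-injective (false ∷ S) (d ∷ Δ) rs rs′ agree = overwrite-injective S Δ rs rs′ (agree ∘ suc)

-- Each vector equals overwrite S Δ r for exactly q ^ selected S pairs (Δ , r).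
∑-overwrite : ∀ q m (S : Vec Bool m) (h : Vec (Fin q) m → ℕ) →
  q ^ selected S * ∑ (allVecs q m) h ≡ ∑ (allVecs q m) (λ Δ → ∑ (allVecs q (selected S)) (λ r → h (overwrite S Δ r)))
∑-overwrite q zero [] h = trans (*-identityˡ _) (sym (+-identityʳ _))
∑-overwrite q (suc m) (false ∷ S) h = begin
  q ^ selected S * ∑ (allVecs q (suc m)) h
    ≡⟨ cong (q ^ selected S *_) (∑-allVecs-suc q m h) ⟩
  q ^ selected S * ∑ (allFin q) (λ d → ∑ (allVecs q m) (λ v → h (d ∷ v)))
    ≡⟨ *-distribˡ-∑ (q ^ selected S) (allFin q) _ ⟩
  ∑ (allFin q) (λ d → q ^ selected S * ∑ (allVecs q m) (λ v → h (d ∷ v)))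
    ≡⟨ ∑-cong (allFin q) (λ d → ∑-overwrite q m S (λ v → h (d ∷ v))) ⟩
  ∑ (allFin q) (λ d → ∑ (allVecs q m) (λ Δ → ∑ (allVecs q (selected S)) (λ r → h (d ∷ overwrite S Δ r))))
    ≡⟨ ∑-allVecs-suc q m _ ⟨
  ∑ (allVecs q (suc m)) (λ Δ → ∑ (allVecs q (selected S)) (λ r → h (overwrite (false ∷ S) Δ r)))
    ∎
  where open ≡-Reasoning
∑-overwrite q (suc m) (true ∷ S) h = begin
  q * q ^ selected S * X
    ≡⟨ *-assoc q _ X ⟩
  q * (q ^ selected S * X)
    ≡⟨ cong (_* (q ^ selected S * X)) (length-allFin q) ⟨
  length (allFin q) * (q ^ selected S * X)
    ≡⟨ ∑-const (allFin q) _ ⟨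
  ∑ (allFin q) (λ _ → q ^ selected S * X)
    ≡⟨ ∑-cong (allFin q) (λ _ → cong (q ^ selected S *_) (∑-allVecs-suc q m h)) ⟩
  ∑ (allFin q) (λ _ → q ^ selected S * ∑ (allFin q) (λ d′ → ∑ (allVecs q m) (λ v → h (d′ ∷ v))))
    ≡⟨ ∑-cong (allFin q) (λ _ → *-distribˡ-∑ (q ^ selected S) (allFin q) _) ⟩
  ∑ (allFin q) (λ _ → ∑ (allFin q) (λ d′ → q ^ selected S * ∑ (allVecs q m) (λ v → h (d′ ∷ v))))
    ≡⟨ ∑-cong (allFin q) (λ _ → ∑-cong (allFin q) (λ d′ → ∑-overwrite q m S (λ v → h (d′ ∷ v)))) ⟩
  ∑ (allFin q) (λ _ → ∑ (allFin q) (λ d′ → ∑ (allVecs q m) (λ Δ → ∑ (allVecs q (selected S)) (λ r → h (d′ ∷ overwrite S Δ r)))))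
    ≡⟨ ∑-cong (allFin q) (λ _ → ∑-comm (allVecs q m) (allFin q) _) ⟨
  ∑ (allFin q) (λ _ → ∑ (allVecs q m) (λ Δ → ∑ (allFin q) (λ d′ → ∑ (allVecs q (selected S)) (λ r → h (d′ ∷ overwrite S Δ r)))))
    ≡⟨ ∑-cong (allFin q) (λ _ → ∑-cong (allVecs q m) (λ Δ → ∑-allVecs-suc q (selected S) _)) ⟨
  ∑ (allFin q) (λ d → ∑ (allVecs q m) (λ Δ → ∑ (allVecs q (suc (selected S))) (λ r → h (overwrite (true ∷ S) (d ∷ Δ) r))))
    ≡⟨ ∑-allVecs-suc q m _ ⟨
  ∑ (allVecs q (suc m)) (λ Δ → ∑ (allVecs q (selected (true ∷ S))) (λ r → h (overwrite (true ∷ S) Δ r)))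
    ∎
  where
  open ≡-Reasoning
  X = ∑ (allVecs q (suc m)) h

readFirst : ∀ {w} → Cell w → List (Event w) → Bool
readFirst c [] = false
readFirst c (e ∷ es) = isReadOf c e ∨ (not (isWriteOf c e) ∧ readFirst c es)

module Execution {w q : ℕ} (A : Algo w q) where

  memAfter : ℕ → Mem w → List (Fin q) → Mem w
  memAfter t m [] = m
  memAfter t m (d ∷ ds) = memAfter (suc t) (proj₁ (runOp t m (op A d))) ds

  outputs : ℕ → Mem w → List (Fin q) → List (Fin q)
  outputs t m ds = proj₁ (exec A t m ds)

  trace : ℕ → Mem w → List (Fin q) → List (Event w)
  trace t m ds = proj₂ (exec A t m ds)

  outputs-++ : ∀ t m xs ys → outputs t m (xs ++ ys) ≡ outputs t m xs ++ outputs (t + length xs) (memAfter t m xs) ys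
  outputs-++ t m [] ys rewrite +-identityʳ t = refl
  outputs-++ t m (d ∷ xs) ys rewrite +-suc t (length xs) = cong (_ ∷_) (outputs-++ (suc t) _ xs ys)

  trace-++ : ∀ t m xs ys → trace t m (xs ++ ys) ≡ trace t m xs ++ trace (t + length xs) (memAfter t m xs) ys
  trace-++ t m [] ys rewrite +-identityʳ t = refl
  trace-++ t m (d ∷ xs) ys rewrite +-suc t (length xs) =
    trans (cong (probes ++_) (trace-++ (suc t) _ xs ys)) (sym (Listₚ.++-assoc probes _ _))
    where probes = proj₂ (proj₂ (runOp t m (op A d)))

  length-outputs : ∀ t m ds → length (outputs t m ds) ≡ length ds
  length-outputs t m [] = refl
  length-outputs t m (d ∷ ds) = cong suc (length-outputs (suc t) _ ds)

  runOp-times : ∀ t m (τ : Tree w q) → All (λ e → time e ≡ t) (proj₂ (proj₂ (runOp t m τ)))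
  runOp-times t m (read c k) = refl ∷ runOp-times t m (k (m c))
  runOp-times t m (write c v k) = refl ∷ runOp-times t (update {w} m c v) k
  runOp-times t m (ret o) = []

  trace-times : ∀ t m ds → All (λ e → t ≤ time e × time e < t + length ds) (trace t m ds)
  trace-times t m [] = []
  trace-times t m (d ∷ ds) = All.++⁺
    (All.map (λ e≡t → ≤-reflexive (sym e≡t) , subst (_< t + suc (length ds)) (sym e≡t) (m<m+n t (s≤s z≤n)))
             (runOp-times t m (op A d)))
    (All.map (λ { {e} (t<e , e<) → ≤-trans (n≤1+n t) t<e , subst (time {w} e <_) (sym (+-suc t (length ds))) e< })
             (trace-times (suc t) _ ds))

  runOp-unwritten : ∀ t m (τ : Tree w q) c → All (λ e → isWriteOf c e ≡ false) (proj₂ (proj₂ (runOp t m τ))) →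
    proj₁ (runOp t m τ) c ≡ m c
  runOp-unwritten t m (read c′ k) c (_ ∷ unwritten) = runOp-unwritten t m (k (m c′)) c unwritten
  runOp-unwritten t m (write c′ v k) c (c≢c′ ∷ unwritten) =
    trans (runOp-unwritten t (update {w} m c′ v) k c unwritten) update-other
    where
    update-other : update {w} m c′ v c ≡ m c
    update-other rewrite c≢c′ = refl
  runOp-unwritten t m (ret o) c _ = refl

  memAfter-unwritten : ∀ t m ds c → All (λ e → isWriteOf c e ≡ false) (trace t m ds) → memAfter t m ds c ≡ m c
  memAfter-unwritten t m [] c _ = refl
  memAfter-unwritten t m (d ∷ ds) c unwritten with All.++⁻ (proj₂ (proj₂ (runOp t m (op A d)))) unwritten
  ... | now , later = trans (memAfter-unwritten (suc t) _ ds c later) (runOp-unwritten t m (op A d) c now)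

  update-agree : ∀ t (m m′ : Mem w) c v (es : List (Event w)) →
    (∀ c′ → readFirst c′ (ev t W! c ∷ es) ≡ true → m c′ ≡ m′ c′) →
    ∀ c′ → readFirst c′ es ≡ true → update {w} m c v c′ ≡ update {w} m′ c v c′
  update-agree t m m′ c v es agree c′ r with toℕ c′ ≡ᵇ toℕ c in c′≟c
  ... | true = refl
  ... | false = agree c′ (subst (λ b → (false ∨ (not b ∧ readFirst c′ es)) ≡ true) (sym c′≟c) r)

  runOp-agree : ∀ t (τ : Tree w q) (m m′ : Mem w) (rest : List (Event w)) →
    (∀ c → readFirst c (proj₂ (proj₂ (runOp t m τ)) ++ rest) ≡ true → m c ≡ m′ c) →
    (proj₁ (proj₂ (runOp t m τ)) ≡ proj₁ (proj₂ (runOp t m′ τ))) ×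
    (proj₂ (proj₂ (runOp t m τ)) ≡ proj₂ (proj₂ (runOp t m′ τ))) ×
    (∀ c → readFirst c rest ≡ true → proj₁ (runOp t m τ) c ≡ proj₁ (runOp t m′ τ) c)
  runOp-agree t (read c k) m m′ rest agree
    with same-cell ← agree c (cong (_∨ readFirst c (proj₂ (proj₂ (runOp t m (k (m c)))) ++ rest)) (≡ᵇ-refl (toℕ c)))
       | same-out , same-trace , same-mem ← runOp-agree t (k (m c)) m m′ rest (λ c′ r → agree c′ (∨-≡-trueʳ (toℕ c′ ≡ᵇ toℕ c) r))
    rewrite sym same-cell = same-out , cong (ev t R! c ∷_) same-trace , same-mem
  runOp-agree t (write c v k) m m′ rest agree
    with same-out , same-trace , same-mem ←
           runOp-agree t k (update {w} m c v) (update {w} m′ c v) rest (update-agree t m m′ c v (proj₂ (proj₂ (runOp t (update {w} m c v) k)) ++ rest) agree)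
    = same-out , cong (ev t W! c ∷_) same-trace , same-mem
  runOp-agree t (ret o) m m′ rest agree = refl , refl , agree

  exec-agree : ∀ t ds (m m′ : Mem w) → (∀ c → readFirst c (trace t m ds) ≡ true → m c ≡ m′ c) → exec A t m ds ≡ exec A t m′ ds
  exec-agree t [] m m′ _ = refl
  exec-agree t (d ∷ ds) m m′ agree
    with same-out , same-trace , same-mem ← runOp-agree t (op A d) m m′ (trace (suc t) (proj₁ (runOp t m (op A d))) ds) agree
    with rest ← exec-agree (suc t) ds (proj₁ (runOp t m (op A d))) (proj₁ (runOp t m′ (op A d))) same-mem
    = cong₂ _,_ (cong₂ _∷_ same-out (cong proj₁ rest)) (cong₂ _++_ same-trace (cong proj₂ rest))

module _ {w : ℕ} (c : Cell w) (t₁ t₂ : ℕ) where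

  readNotOverwritten-shift : (pre mid rest : List (Event w)) →
    readNotOverwritten c t₁ t₂ (pre ++ mid) rest ≡ true → readNotOverwritten c t₁ t₂ pre (mid ++ rest) ≡ true
  readNotOverwritten-shift pre [] rest r = subst (λ z → readNotOverwritten c t₁ t₂ z rest ≡ true) (Listₚ.++-identityʳ pre) r
  readNotOverwritten-shift pre (e ∷ mid) rest r = ∨-≡-trueʳ _ (readNotOverwritten-shift (pre ++ e ∷ []) mid rest
    (subst (λ z → readNotOverwritten c t₁ t₂ z rest ≡ true) (sym (Listₚ.++-assoc pre (e ∷ []) mid)) r))

  readNotOverwritten-++ : (pre es later : List (Event w)) →
    readNotOverwritten c t₁ t₂ pre es ≡ true → readNotOverwritten c t₁ t₂ pre (es ++ later) ≡ true
  readNotOverwritten-++ pre (e ∷ es) later = ∨-monoʳ-≡-true _ (readNotOverwritten-++ (pre ++ e ∷ []) es later)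

  early-write-not-late : ∀ x (e : Event w) → (isWriteOf c e ≡ true → time e ≤ t₁) → (isWriteOf c e ∧ inI (suc t₁) x (time e)) ≡ false
  early-write-not-late x e early with isWriteOf c e
  ... | false = refl
  ... | true rewrite ≰⇒≤ᵇ≡false {suc t₁} {time e} (λ t₁<e → <-irrefl refl (≤-trans t₁<e (early refl))) = refl

  readFirst⇒readNotOverwritten : (es pre : List (Event w)) →
    All (λ e → isWriteOf c e ≡ true → time e ≤ t₁) pre →
    All (λ e → suc t₁ ≤ time e × time e ≤ t₂) es →
    readFirst c es ≡ true → readNotOverwritten c t₁ t₂ pre es ≡ true
  readFirst⇒readNotOverwritten (e ∷ es) pre early-writes ((t₁<e , e≤t₂) ∷ es-in) first with isReadOf c e
  ... | true rewrite ≤⇒≤ᵇ≡true t₁<e | ≤⇒≤ᵇ≡true e≤t₂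
        | any-≡-false⁺ (λ e′ → isWriteOf c e′ ∧ inI (suc t₁) (time e) (time e′)) pre
                       (All.map (λ {e′} → early-write-not-late (time e) e′) early-writes) = refl
  ... | false = ∨-≡-trueʳ _ (readFirst⇒readNotOverwritten es (pre ++ e ∷ [])
          (All.++⁺ early-writes ((λ written → ⊥-elim (false≢true written)) ∷ [])) es-in (∧-conicalʳ _ _ first))
    where
    false≢true : isWriteOf c e ≡ true → ⊥
    false≢true written with trans (sym written) (not-≡-true (∧-conicalˡ _ _ first))
    ... | ()

nth : List ℕ → ℕ → ℕ
nth [] _ = 0
nth (x ∷ xs) zero = x
nth (x ∷ xs) (suc i) = nth xs i

nth-++ʳ : ∀ xs ys j → nth (xs ++ ys) (length xs + j) ≡ nth ys j
nth-++ʳ [] ys j = refl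
nth-++ʳ (x ∷ xs) ys j = nth-++ʳ xs ys j

nth-++ˡ : ∀ xs ys j → j < length xs → nth (xs ++ ys) j ≡ nth xs j
nth-++ˡ (x ∷ xs) ys zero _ = refl
nth-++ˡ (x ∷ xs) ys (suc j) (s≤s j<) = nth-++ˡ xs ys j j<

nth-map-upTo : ∀ (f : ℕ → ℕ) n t → t < n → nth (map f (upTo n)) t ≡ f t
nth-map-upTo f n t t<n = trans (cong (λ z → nth z t) (Listₚ.map-applyUpTo id f n)) (nth-applyUpTo f n t t<n)
  where
  nth-applyUpTo : ∀ (g : ℕ → ℕ) n t → t < n → nth (applyUpTo g n) t ≡ g t
  nth-applyUpTo g (suc n) zero _ = refl
  nth-applyUpTo g (suc n) (suc t) (s≤s t<n) = nth-applyUpTo (g ∘ suc) n t t<n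

atₗ : ∀ {q} → List (Fin q) → ℕ → ℕ
atₗ [] i = 0
atₗ (x ∷ xs) zero = toℕ x
atₗ (x ∷ xs) (suc i) = atₗ xs i

at≡atₗ-toL : ∀ {q m} (v : Vec (Fin q) m) i → at v i ≡ atₗ (toL v) i
at≡atₗ-toL [] i = refl
at≡atₗ-toL (x ∷ v) zero = refl
at≡atₗ-toL (x ∷ v) (suc i) = at≡atₗ-toL v i

length-toL : ∀ {A : Set} {m} (v : Vec A m) → length (toL v) ≡ m
length-toL [] = refl
length-toL (x ∷ v) = cong suc (length-toL v)

atₗ-take : ∀ {q} k (xs : List (Fin q)) i → i < k → atₗ (take k xs) i ≡ atₗ xs i
atₗ-take (suc k) [] i _ = refl
atₗ-take (suc k) (x ∷ xs) zero _ = refl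
atₗ-take (suc k) (x ∷ xs) (suc i) (s≤s i<k) = atₗ-take k xs i i<k

atₗ-drop : ∀ {q} k (xs : List (Fin q)) i → atₗ (drop k xs) i ≡ atₗ xs (k + i)
atₗ-drop zero xs i = refl
atₗ-drop (suc k) [] i = refl
atₗ-drop (suc k) (x ∷ xs) i = atₗ-drop k xs i

atₗ-extensionality : ∀ {q} (xs ys : List (Fin q)) → length xs ≡ length ys →
  (∀ i → i < length xs → atₗ xs i ≡ atₗ ys i) → xs ≡ ys
atₗ-extensionality [] [] _ _ = refl
atₗ-extensionality (x ∷ xs) (y ∷ ys) ∣xs∣≡ same =
  cong₂ _∷_ (Fin.toℕ-injective (same 0 (s≤s z≤n))) (atₗ-extensionality xs ys (suc-injective ∣xs∣≡) (λ i i< → same (suc i) (s≤s i<)))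

length-take-≤ : {A : Set} (k : ℕ) (xs : List A) → k ≤ length xs → length (take k xs) ≡ k
length-take-≤ k xs k≤ = trans (Listₚ.length-take k xs) (m≤n⇒m⊓n≡m k≤)

-- Decoding the read phase from the information transfer

decodeCell : ∀ {w} → List (Cell w × Word w) → Cell w → Word w → Word w
decodeCell [] c d = d
decodeCell {w} ((c′ , v) ∷ msg) c d = if toℕ c′ ≡ᵇ toℕ c then v else decodeCell {w} msg c d

cell-≡ : ∀ {w} {a b : Cell w} → (toℕ a ≡ᵇ toℕ b) ≡ true → a ≡ b
cell-≡ a≟b = Fin.toℕ-injective (≡ᵇ⇒≡′ a≟b)

module _ {w : ℕ} (m : Mem w) (p : Cell w → Bool) where

  private
    encode : List (Cell w) → List (Cell w × Word w)
    encode cs = map (λ c → c , m c) (filterᵇ p cs)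

  decodeCell-unmarked : ∀ cs c d → p c ≡ false → decodeCell {w} (encode cs) c d ≡ d
  decodeCell-unmarked [] c d _ = refl
  decodeCell-unmarked (c′ ∷ cs) c d pc with p c′ in pc′
  ... | false = decodeCell-unmarked cs c d pc
  ... | true with toℕ c′ ≡ᵇ toℕ c in c′≟c
  ...   | false = decodeCell-unmarked cs c d pc
  ...   | true with cell-≡ {w} {c′} {c} c′≟c
  ...     | refl with trans (sym pc′) pc
  ...       | ()

  decodeCell-encode : ∀ cs c d → c ∈ cs → decodeCell {w} (encode cs) c d ≡ (if p c then m c else d)
  decodeCell-encode (c′ ∷ cs) c d c∈ with p c′ in pc′
  decodeCell-encode (c′ ∷ cs) c d c∈ | true with toℕ c′ ≡ᵇ toℕ c in c′≟c
  ... | true with cell-≡ {w} {c′} {c} c′≟c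
  ...   | refl rewrite pc′ = refl
  decodeCell-encode (c′ ∷ cs) c d (here refl) | true | false with trans (sym c′≟c) (≡ᵇ-refl (toℕ c′))
  ... | ()
  decodeCell-encode (c′ ∷ cs) c d (there c∈) | true | false = decodeCell-encode cs c d c∈
  decodeCell-encode (c′ ∷ cs) c d (here refl) | false rewrite pc′ = decodeCell-unmarked cs c′ d pc′
  decodeCell-encode (c′ ∷ cs) c d (there c∈) | false = decodeCell-encode cs c d c∈

module Decoding {w q : ℕ} (A : Algo w q) (t₀ ℓ t₁ t₂ : ℕ) (t₁≡ : suc t₁ ≡ t₀ + ℓ) (t₂≡ : suc t₂ ≡ t₀ + ℓ + ℓ) where
  open Execution A

  -- The input splits into phases ending at times t₀ − 1, t₁, t₂ and n − 1; mem₀ and mem₁ are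
  -- the memories at times t₀ and t₁ + 1.
  module _ (L : List (Fin q)) where
    past = take t₀ L
    written = take ℓ (drop t₀ L)
    probed = take ℓ (drop ℓ (drop t₀ L))
    future = drop ℓ (drop ℓ (drop t₀ L))
    mem₀ = memAfter 0 (init A) past
    mem₁ = memAfter t₀ mem₀ written
    mem₂ = memAfter (t₀ + ℓ) mem₁ probed
    trace-past = trace 0 (init A) past
    trace-written = trace t₀ mem₀ written
    trace-probed = trace (t₀ + ℓ) mem₁ probed
    trace-future = trace (t₀ + ℓ + ℓ) mem₂ future
    transferred : Cell w → Bool
    transferred = inIT t₀ t₁ t₂ (trace 0 (init A) L)
    hybrid : Mem w
    hybrid c = if transferred c then mem₁ c else mem₀ c
    message : List (Cell w × Word w)
    message = map (λ c → c , mem₁ c) (filterᵇ transferred (allFin (2 ^ w)))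
    outputs-probed = outputs (t₀ + ℓ) mem₁ probed

  input-split : ∀ L → L ≡ past L ++ (written L ++ (probed L ++ future L))
  input-split L = sym (trans (cong (past L ++_) (trans (cong (written L ++_) (Listₚ.take++drop≡id ℓ (drop ℓ (drop t₀ L))))
                                                         (Listₚ.take++drop≡id ℓ (drop t₀ L))))
                             (Listₚ.take++drop≡id t₀ L))

  module _ (L : List (Fin q)) (long : t₀ + ℓ + ℓ ≤ length L) where

    length-past : length (past L) ≡ t₀
    length-past = length-take-≤ t₀ L (≤-trans (m≤m+n t₀ ℓ) (≤-trans (m≤m+n (t₀ + ℓ) ℓ) long))

    private
      length-drop≥ : ∀ {A : Set} k m (xs : List A) → k + m ≤ length xs → m ≤ length (drop k xs)
      length-drop≥ k m xs k+m≤ = subst (m ≤_) (sym (Listₚ.length-drop k xs))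
                                   (subst (_≤ length xs ∸ k) (m+n∸m≡n k m) (∸-monoˡ-≤ k k+m≤))
      ℓ+ℓ≤ : ℓ + ℓ ≤ length (drop t₀ L)
      ℓ+ℓ≤ = length-drop≥ t₀ (ℓ + ℓ) L (subst (_≤ length L) (+-assoc t₀ ℓ ℓ) long)

    length-written : length (written L) ≡ ℓ
    length-written = length-take-≤ ℓ (drop t₀ L) (≤-trans (m≤m+n ℓ ℓ) ℓ+ℓ≤)

    length-probed : length (probed L) ≡ ℓ
    length-probed = length-take-≤ ℓ (drop ℓ (drop t₀ L)) (length-drop≥ ℓ ℓ (drop t₀ L) ℓ+ℓ≤)

    private
      split-at : ∀ {B : Set} (run : ℕ → Mem w → List (Fin q) → List B) → (∀ t m xs ys → run t m (xs ++ ys) ≡ run t m xs ++ run (t + length xs) (memAfter t m xs) ys) →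
        run 0 (init A) L ≡ run 0 (init A) (past L) ++ (run t₀ (mem₀ L) (written L) ++ (run (t₀ + ℓ) (mem₁ L) (probed L) ++ run (t₀ + ℓ + ℓ) (mem₂ L) (future L)))
      split-at run run-++ = begin
        run 0 (init A) L                                                     ≡⟨ cong (run 0 (init A)) (input-split L) ⟩
        run 0 (init A) (P ++ (W ++ (S ++ F)))                                ≡⟨ run-++ 0 (init A) P (W ++ (S ++ F)) ⟩
        run 0 (init A) P ++ run (0 + length P) (mem₀ L) (W ++ (S ++ F))      ≡⟨ cong (λ t → run 0 (init A) P ++ run t (mem₀ L) (W ++ (S ++ F))) length-past ⟩
        run 0 (init A) P ++ run t₀ (mem₀ L) (W ++ (S ++ F))                  ≡⟨ cong (run 0 (init A) P ++_) (run-++ t₀ (mem₀ L) W (S ++ F)) ⟩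
        run 0 (init A) P ++ (run t₀ (mem₀ L) W ++ run (t₀ + length W) (mem₁ L) (S ++ F))
          ≡⟨ cong (λ t → run 0 (init A) P ++ (run t₀ (mem₀ L) W ++ run (t₀ + t) (mem₁ L) (S ++ F))) length-written ⟩
        run 0 (init A) P ++ (run t₀ (mem₀ L) W ++ run (t₀ + ℓ) (mem₁ L) (S ++ F))
          ≡⟨ cong (λ z → run 0 (init A) P ++ (run t₀ (mem₀ L) W ++ z)) (run-++ (t₀ + ℓ) (mem₁ L) S F) ⟩
        run 0 (init A) P ++ (run t₀ (mem₀ L) W ++ (run (t₀ + ℓ) (mem₁ L) S ++ run (t₀ + ℓ + length S) (mem₂ L) F))
          ≡⟨ cong (λ t → run 0 (init A) P ++ (run t₀ (mem₀ L) W ++ (run (t₀ + ℓ) (mem₁ L) S ++ run (t₀ + ℓ + t) (mem₂ L) F))) length-probed ⟩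
        run 0 (init A) P ++ (run t₀ (mem₀ L) W ++ (run (t₀ + ℓ) (mem₁ L) S ++ run (t₀ + ℓ + ℓ) (mem₂ L) F))
          ∎
        where
        open ≡-Reasoning
        P = past L
        W = written L
        S = probed L
        F = future L

    trace-split : trace 0 (init A) L ≡ trace-past L ++ (trace-written L ++ (trace-probed L ++ trace-future L))
    trace-split = split-at trace trace-++

    outputs-split : outputs 0 (init A) L ≡ outputs 0 (init A) (past L) ++ (outputs t₀ (mem₀ L) (written L) ++ (outputs-probed L ++ outputs (t₀ + ℓ + ℓ) (mem₂ L) (future L)))
    outputs-split = split-at outputs outputs-++

    private
      before-t₁ : ∀ {x} → x < t₀ + ℓ → x ≤ t₁
      before-t₁ {x} x< = ≤-pred (subst (x <_) (sym t₁≡) x<)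

      times-written : All (λ e → t₀ ≤ time e × time e ≤ t₁) (trace-written L)
      times-written = All.map (λ { {e} (t₀≤ , e<) → t₀≤ , before-t₁ (subst (time {w} e <_) (cong (t₀ +_) length-written) e<) })
                              (trace-times t₀ (mem₀ L) (written L))

      times-probed : All (λ e → suc t₁ ≤ time e × time e ≤ t₂) (trace-probed L)
      times-probed = All.map (λ { {e} (≤e , e<) → subst (_≤ time {w} e) (sym t₁≡) ≤e
                                                , ≤-pred (subst (time {w} e <_) (trans (cong (t₀ + ℓ +_) length-probed) (sym t₂≡)) e<) })
                             (trace-times (t₀ + ℓ) (mem₁ L) (probed L))

      times-early : All (λ e → time e ≤ t₁) (trace-past L ++ trace-written L)
      times-early = All.++⁺ (All.map (λ { (_ , e<) → before-t₁ (≤-trans e< (subst (_≤ t₀ + ℓ) (sym length-past) (m≤m+n t₀ ℓ))) })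
                                     (trace-times 0 (init A) (past L)))
                            (All.map proj₂ times-written)

    readFirst⇒readNotOverwritten-probed : ∀ c → readFirst c (trace-probed L) ≡ true →
      readNotOverwritten c t₁ t₂ [] (trace 0 (init A) L) ≡ true
    readFirst⇒readNotOverwritten-probed c first =
      subst (λ es → readNotOverwritten c t₁ t₂ [] es ≡ true) (trans (Listₚ.++-assoc (trace-past L) (trace-written L) _) (sym trace-split))
        (readNotOverwritten-shift c t₁ t₂ [] (trace-past L ++ trace-written L) (trace-probed L ++ trace-future L)
          (readNotOverwritten-++ c t₁ t₂ (trace-past L ++ trace-written L) (trace-probed L) (trace-future L)
            (readFirst⇒readNotOverwritten c t₁ t₂ (trace-probed L) (trace-past L ++ trace-written L)
              (All.map (λ e≤t₁ _ → e≤t₁) times-early) times-probed first)))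

    -- By the definition of IT, such a cell is not written during [t₀, t₁].
    untransferred-unchanged : ∀ c → readFirst c (trace-probed L) ≡ true → transferred L c ≡ false → mem₁ L c ≡ mem₀ L c
    untransferred-unchanged c first not-transferred = memAfter-unwritten t₀ (mem₀ L) (written L) c no-write
      where
      written-in-window : Event w → Bool
      written-in-window e = isWriteOf c e ∧ inI t₀ t₁ (time e)
      none : All (λ e → written-in-window e ≡ false) (trace 0 (init A) L)
      none = any-≡-false⁻ written-in-window (trace 0 (init A) L)
               (∧-≡-false⇒≡-false not-transferred (readFirst⇒readNotOverwritten-probed c first))
      none-written : All (λ e → written-in-window e ≡ false) (trace-written L)
      none-written = All.++⁻ˡ (trace-written L) (All.++⁻ʳ (trace-past L) (subst (All (λ e → written-in-window e ≡ false)) trace-split none))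
      no-write : All (λ e → isWriteOf c e ≡ false) (trace-written L)
      no-write = All.zipWith (λ { (not-in , t₀≤ , ≤t₁) → ∧-≡-false⇒≡-false not-in (cong₂ _∧_ (≤⇒≤ᵇ≡true t₀≤) (≤⇒≤ᵇ≡true ≤t₁)) })
                             (none-written , times-written)

    probed-from-hybrid : exec A (t₀ + ℓ) (mem₁ L) (probed L) ≡ exec A (t₀ + ℓ) (hybrid L) (probed L)
    probed-from-hybrid = exec-agree (t₀ + ℓ) (probed L) (mem₁ L) (hybrid L) agree
      where
      agree : ∀ c → readFirst c (trace-probed L) ≡ true → mem₁ L c ≡ hybrid L c
      agree c first with transferred L c in tc
      ... | true = refl
      ... | false = untransferred-unchanged c first tc

  hybrid-decode : ∀ L c → hybrid L c ≡ decodeCell {w} (message L) c (mem₀ L c)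
  hybrid-decode L c = sym (decodeCell-encode (mem₁ L) (transferred L) (allFin (2 ^ w)) c (mem₀ L c) (∈-allFin c))

  outputs-probed-determined : ∀ L L′ → t₀ + ℓ + ℓ ≤ length L → t₀ + ℓ + ℓ ≤ length L′ →
    past L ≡ past L′ → probed L ≡ probed L′ → message L ≡ message L′ → outputs-probed L ≡ outputs-probed L′
  outputs-probed-determined L L′ long long′ same-past same-probed same-message = begin
    outputs-probed L                          ≡⟨ cong proj₁ (probed-from-hybrid L long) ⟩
    outputs (t₀ + ℓ) (hybrid L) (probed L)    ≡⟨ cong proj₁ (exec-agree (t₀ + ℓ) (probed L) (hybrid L) (hybrid L′) (λ c _ → same-hybrid c)) ⟩
    outputs (t₀ + ℓ) (hybrid L′) (probed L)   ≡⟨ cong (outputs (t₀ + ℓ) (hybrid L′)) same-probed ⟩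
    outputs (t₀ + ℓ) (hybrid L′) (probed L′)  ≡⟨ cong proj₁ (probed-from-hybrid L′ long′) ⟨
    outputs-probed L′                         ∎
    where
    open ≡-Reasoning
    same-hybrid : ∀ c → hybrid L c ≡ hybrid L′ c
    same-hybrid c = trans (hybrid-decode L c)
      (trans (cong₂ (λ msg m → decodeCell {w} msg c (m c)) same-message (cong (memAfter 0 (init A)) same-past)) (sym (hybrid-decode L′ c)))

  nth-outputs-probed : ∀ L → t₀ + ℓ + ℓ ≤ length L → ∀ i → i < ℓ →
    nth (map toℕ (outputs 0 (init A) L)) (t₀ + ℓ + i) ≡ nth (map toℕ (outputs-probed L)) i
  nth-outputs-probed L long i i<ℓ = begin
    nth (map toℕ (outputs 0 (init A) L)) (t₀ + ℓ + i)          ≡⟨ cong₂ nth (trans (cong (map toℕ) (outputs-split L long)) map-split) position ⟩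
    nth (oP ++ (oW ++ (oS ++ oF))) (length oP + (length oW + i)) ≡⟨ nth-++ʳ oP _ _ ⟩
    nth (oW ++ (oS ++ oF)) (length oW + i)                       ≡⟨ nth-++ʳ oW _ _ ⟩
    nth (oS ++ oF) i                                             ≡⟨ nth-++ˡ oS oF i (subst (i <_) (sym length-oS) i<ℓ) ⟩
    nth oS i                                                     ∎
    where
    open ≡-Reasoning
    oP = map toℕ (outputs 0 (init A) (past L))
    oW = map toℕ (outputs t₀ (mem₀ L) (written L))
    oS = map toℕ (outputs-probed L)
    oF = map toℕ (outputs (t₀ + ℓ + ℓ) (mem₂ L) (future L))
    map-split : map toℕ (outputs 0 (init A) (past L) ++ (outputs t₀ (mem₀ L) (written L) ++ (outputs-probed L ++ outputs (t₀ + ℓ + ℓ) (mem₂ L) (future L))))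
              ≡ oP ++ (oW ++ (oS ++ oF))
    map-split = trans (Listₚ.map-++ toℕ (outputs 0 (init A) (past L)) _)
      (cong (oP ++_) (trans (Listₚ.map-++ toℕ (outputs t₀ (mem₀ L) (written L)) _)
      (cong (oW ++_) (Listₚ.map-++ toℕ (outputs-probed L) (outputs (t₀ + ℓ + ℓ) (mem₂ L) (future L))))))
    length-oS : length oS ≡ ℓ
    length-oS = trans (Listₚ.length-map toℕ (outputs-probed L)) (trans (length-outputs (t₀ + ℓ) (mem₁ L) (probed L)) (length-probed L long))
    position : t₀ + ℓ + i ≡ length oP + (length oW + i)
    position = trans (+-assoc t₀ ℓ i) (sym (cong₂ (λ a b → a + (b + i))
      (trans (Listₚ.length-map toℕ (outputs 0 (init A) (past L))) (trans (length-outputs 0 (init A) (past L)) (length-past L long)))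
      (trans (Listₚ.length-map toℕ (outputs t₀ (mem₀ L) (written L))) (trans (length-outputs t₀ (mem₀ L) (written L)) (length-written L long)))))

sumTo : ℕ → (ℕ → ℕ) → ℕ
sumTo zero f = 0
sumTo (suc m) f = f 0 + sumTo m (f ∘ suc)

Σ<≡sumTo : ∀ m f → Σ< m f ≡ sumTo m f
Σ<≡sumTo m f = go id m
  where
  go : ∀ (g : ℕ → ℕ) m → sum (map f (applyUpTo g m)) ≡ sumTo m (f ∘ g)
  go g zero = refl
  go g (suc m) = cong (f (g 0) +_) (go (g ∘ suc) m)

sumTo-+ : ∀ a b f → sumTo (a + b) f ≡ sumTo a f + sumTo b (λ j → f (a + j))
sumTo-+ zero b f = refl
sumTo-+ (suc a) b f = trans (cong (f 0 +_) (sumTo-+ a b (f ∘ suc))) (sym (+-assoc (f 0) _ _))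

sumTo-cong : ∀ m {f g} → (∀ i → i < m → f i ≡ g i) → sumTo m f ≡ sumTo m g
sumTo-cong zero _ = refl
sumTo-cong (suc m) f≗g = cong₂ _+_ (f≗g 0 (s≤s z≤n)) (sumTo-cong m (λ i i<m → f≗g (suc i) (s≤s i<m)))

sumTo-zero : ∀ m f → (∀ i → i < m → f i ≡ 0) → sumTo m f ≡ 0
sumTo-zero m f f≗0 = trans (sumTo-cong m f≗0) (go m)
  where
  go : ∀ m → sumTo m (λ _ → 0) ≡ 0
  go zero = refl
  go (suc m) = go m

indicator : Bool → ℕ
indicator b = if b then 1 else 0

selected-tabulate : ∀ m (s : ℕ → Bool) → selected (tabulate {n = m} (s ∘ toℕ)) ≡ sumTo m (indicator ∘ s)
selected-tabulate zero s = refl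
selected-tabulate (suc m) s with s 0
... | true = cong suc (selected-tabulate m (s ∘ suc))
... | false = selected-tabulate m (s ∘ suc)

selects-tabulate : ∀ m (s : ℕ → Bool) i → selects (tabulate {n = m} (s ∘ toℕ)) i ≡ true → s i ≡ true
selects-tabulate (suc m) s zero si = si
selects-tabulate (suc m) s (suc i) si = selects-tabulate m (s ∘ suc) i si

count-tabulate : ∀ {A : Set} m (p : A → Bool) (g : Fin m → A) (s : ℕ → Bool) → (∀ k → s (toℕ k) ≡ p (g k)) →
  count p (List.tabulate g) ≡ sumTo m (indicator ∘ s)
count-tabulate zero p g s _ = refl
count-tabulate (suc m) p g s s≗p =
  cong₂ _+_ (cong indicator (sym (s≗p zero))) (count-tabulate m p (g ∘ suc) (s ∘ suc) (s≗p ∘ suc))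

%-+-cancelʳ : ∀ a b c q .{{_ : NonZero q}} → (a + c) % q ≡ (b + c) % q → a % q ≡ b % q
%-+-cancelʳ a b c q eq = begin
  a % q                    ≡⟨ add-complement a ⟨
  (a + c + k) % q          ≡⟨ %-+-congˡ (a + c) (b + c) k eq ⟩
  (b + c + k) % q          ≡⟨ add-complement b ⟩
  b % q                    ∎
  where
  open ≡-Reasoning
  -- c + k is a multiple of q
  k = q ∸ c % q
  %-+-congˡ : ∀ x y z → x % q ≡ y % q → (x + z) % q ≡ (y + z) % q
  %-+-congˡ x y z x≡y = trans (%-distribˡ-+ x z q) (trans (cong (λ r → (r + z % q) % q) x≡y) (sym (%-distribˡ-+ y z q)))
  c+k≡ : c + k ≡ suc (c / q) * q
  c+k≡ = begin
    c + k                        ≡⟨ cong (_+ k) (m≡m%n+[m/n]*n c q) ⟩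
    c % q + c / q * q + k        ≡⟨ cong (_+ k) (+-comm (c % q) _) ⟩
    c / q * q + c % q + k        ≡⟨ +-assoc (c / q * q) (c % q) k ⟩
    c / q * q + (c % q + k)      ≡⟨ cong (c / q * q +_) (m+[n∸m]≡n (<⇒≤ (m%n<n c q))) ⟩
    c / q * q + q                ≡⟨ +-comm (c / q * q) q ⟩
    suc (c / q) * q              ∎
  add-complement : ∀ x → (x + c + k) % q ≡ x % q
  add-complement x = trans (cong (_% q) (trans (+-assoc x c k) (cong (x +_) c+k≡))) ([m+kn]%n≡m%n x (suc (c / q)) q)

-- The convolution as a linear map of a window of the input

module _ {q n : ℕ} (Δ : Vec (Fin q) n) where

  -- After s operations, A[i] holds Δ[i + s − n] when that index is nonnegative, and 0 otherwise.
  Aafter-inside : ∀ s i k → i < n → i + s ≡ n + k → Aafter Δ s i ≡ at Δ k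
  Aafter-inside zero i k i<n i≡ = ⊥-elim (<-irrefl refl (≤-trans i<n (≤-trans (m≤m+n n k) (≤-reflexive (trans (sym i≡) (+-identityʳ i))))))
  Aafter-inside (suc s) i k i<n i+s≡ with suc i <ᵇ n in 1+i<ᵇn
  ... | true = Aafter-inside s (suc i) k (<ᵇ≡true⇒< 1+i<ᵇn) (trans (sym (+-suc i s)) i+s≡)
  ... | false = cong (at Δ) (+-cancelˡ-≡ n s k (trans (cong (_+ s) (sym 1+i≡n)) (trans (sym (+-suc i s)) i+s≡)))
    where
    1+i≡n : suc i ≡ n
    1+i≡n = ≤-antisym i<n (<ᵇ≡false⇒≥ 1+i<ᵇn)

  Aafter-outside : ∀ s i → i + s < n → Aafter Δ s i ≡ 0
  Aafter-outside zero i _ = refl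
  Aafter-outside (suc s) i i+s< with suc i <ᵇ n in 1+i<ᵇn
  ... | true = Aafter-outside s (suc i) (subst (_< n) (+-suc i s) i+s<)
  ... | false = ⊥-elim (<-irrefl refl (≤-trans i+s< (≤-trans (<ᵇ≡false⇒≥ 1+i<ᵇn) (subst (suc i ≤_) (sym (+-suc i s)) (s≤s (m≤m+n i s))))))

atFin : ∀ {q′ m} → Vec (Fin (suc q′)) m → ℕ → Fin (suc q′)
atFin [] i = zero
atFin (x ∷ xs) zero = x
atFin (x ∷ xs) (suc i) = atFin xs i

at≡toℕ-atFin : ∀ {q′ m} (v : Vec (Fin (suc q′)) m) i → at v i ≡ toℕ (atFin v i)
at≡toℕ-atFin [] i = refl
at≡toℕ-atFin (x ∷ v) zero = refl
at≡toℕ-atFin (x ∷ v) (suc i) = at≡toℕ-atFin v i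

at-tabulate : ∀ {q} ℓ (f : ℕ → Fin q) j → j < ℓ → at (tabulate {n = ℓ} (f ∘ toℕ)) j ≡ toℕ (f j)
at-tabulate (suc ℓ) f zero _ = refl
at-tabulate (suc ℓ) f (suc j) (s≤s j<ℓ) = at-tabulate ℓ (f ∘ suc) j j<ℓ

at-lookup : ∀ {q m} (x : Vec (Fin q) m) (k : Fin m) → at x (toℕ k) ≡ toℕ (lookup x k)
at-lookup (a ∷ x) zero = refl
at-lookup (a ∷ x) (suc k) = at-lookup x k

module Convolution {q′ n : ℕ} (V : Vec (Fin (suc q′)) n) (t₀ ℓ : ℕ) where

  private
    q = suc q′

  window : Vec (Fin q) n → Vec (Fin q) ℓ
  window Δ = tabulate (λ j → atFin Δ (t₀ + toℕ j))

  at-window : ∀ Δ j → j < ℓ → at (window Δ) j ≡ at Δ (t₀ + j)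
  at-window Δ j j<ℓ = trans (at-tabulate ℓ (λ j → atFin Δ (t₀ + j)) j j<ℓ) (sym (at≡toℕ-atFin Δ (t₀ + j)))

  AgreeOutside : Vec (Fin q) n → Vec (Fin q) n → Set
  AgreeOutside Δ Δ′ = ∀ p → (p < t₀ ⊎ t₀ + ℓ ≤ p) → at Δ p ≡ at Δ′ p

  -- The answer at time t₀ + ℓ + i, where n = a + ℓ + (i + 1): positions [a, a + ℓ) of A hold the window.
  module Row (i a : ℕ) (n≡ : n ≡ a + (ℓ + suc i)) where

    steps : ℕ
    steps = suc (t₀ + ℓ + i)

    term : Vec (Fin q) n → ℕ → ℕ
    term Δ p = Aafter Δ steps p * at V p

    windowRow : Vec (Fin q) n → ℕ
    windowRow Δ = Σ< ℓ (λ j → Mentry V ℓ i j * at (window Δ) j)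

    private
      a≤n : a ≤ n
      a≤n = subst (a ≤_) (sym n≡) (m≤m+n a _)

      shift-window : ∀ j → a + j + steps ≡ n + (t₀ + j)
      shift-window j = trans (arith a j t₀ ℓ i) (cong (_+ (t₀ + j)) (sym n≡))
        where
        arith : ∀ a j t₀ ℓ i → a + j + (1 + (t₀ + ℓ + i)) ≡ a + (ℓ + (1 + i)) + (t₀ + j)
        arith = solve-∀

      a+steps≡ : a + steps ≡ n + t₀
      a+steps≡ = trans (arith a t₀ ℓ i) (cong (_+ t₀) (sym n≡))
        where
        arith : ∀ a t₀ ℓ i → a + (1 + (t₀ + ℓ + i)) ≡ a + (ℓ + (1 + i)) + t₀
        arith = solve-∀

    term-left : ∀ Δ Δ′ → AgreeOutside Δ Δ′ → ∀ p → p < a → term Δ p ≡ term Δ′ p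
    term-left Δ Δ′ agree p p<a with n ≤? p + steps
    ... | no n≰ = cong (_* at V p) (trans (Aafter-outside Δ steps p (≰⇒> n≰)) (sym (Aafter-outside Δ′ steps p (≰⇒> n≰))))
    ... | yes n≤ with k , n+k≡ ← m≤n⇒∃[o]m+o≡n n≤ =
      cong (_* at V p) (trans (Aafter-inside Δ steps p k p<n (sym n+k≡)) (trans (agree k (inj₁ k<t₀)) (sym (Aafter-inside Δ′ steps p k p<n (sym n+k≡)))))
      where
      p<n : p < n
      p<n = ≤-trans p<a a≤n
      k<t₀ : k < t₀
      k<t₀ = +-cancelˡ-< n k t₀ (subst₂ _<_ (sym n+k≡) a+steps≡ (+-monoˡ-< steps p<a))

    term-window : ∀ Δ j → j < ℓ → term Δ (a + j) ≡ at V (a + j) * at Δ (t₀ + j)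
    term-window Δ j j<ℓ = trans (cong (_* at V (a + j)) (Aafter-inside Δ steps (a + j) (t₀ + j) a+j<n (shift-window j))) (*-comm (at Δ (t₀ + j)) (at V (a + j)))
      where
      a+j<n : a + j < n
      a+j<n = subst (a + j <_) (sym n≡) (+-monoʳ-< a (≤-trans j<ℓ (m≤m+n ℓ (suc i))))

    term-right : ∀ Δ Δ′ → AgreeOutside Δ Δ′ → ∀ j → j < suc i → term Δ (a + (ℓ + j)) ≡ term Δ′ (a + (ℓ + j))
    term-right Δ Δ′ agree j j≤i =
      cong (_* at V (a + (ℓ + j))) (trans (Aafter-inside Δ steps _ k p<n p+steps≡) (trans (agree k (inj₂ (m≤m+n (t₀ + ℓ) j))) (sym (Aafter-inside Δ′ steps _ k p<n p+steps≡))))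
      where
      k = t₀ + ℓ + j
      arith : ∀ a j t₀ ℓ i → a + (ℓ + j) + (1 + (t₀ + ℓ + i)) ≡ a + (ℓ + (1 + i)) + (t₀ + ℓ + j)
      arith = solve-∀
      p+steps≡ : a + (ℓ + j) + steps ≡ n + k
      p+steps≡ = trans (arith a j t₀ ℓ i) (cong (_+ k) (sym n≡))
      p<n : a + (ℓ + j) < n
      p<n = subst (a + (ℓ + j) <_) (sym n≡) (+-monoʳ-< a (+-monoʳ-< ℓ j≤i))

    windowRow≡ : ∀ Δ → windowRow Δ ≡ sumTo ℓ (λ j → term Δ (a + j))
    windowRow≡ Δ = trans (Σ<≡sumTo ℓ _) (sumTo-cong ℓ (λ j j<ℓ → trans (cong₂ _*_ (cong (λ z → at V (z + j)) n∸1∸[ℓ+i]≡a) (at-window Δ j j<ℓ)) (sym (term-window Δ j j<ℓ))))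
      where
      n∸1∸[ℓ+i]≡a : n ∸ 1 ∸ (ℓ + i) ≡ a
      n∸1∸[ℓ+i]≡a = trans (cong (λ z → z ∸ 1 ∸ (ℓ + i)) (trans n≡ (trans (cong (a +_) (+-suc ℓ i)) (+-suc a (ℓ + i))))) (m+n∸n≡m a (ℓ + i))

    answer-split : ∀ Δ → Σ< n (term Δ) ≡ sumTo a (term Δ) + (windowRow Δ + sumTo (suc i) (λ j → term Δ (a + (ℓ + j))))
    answer-split Δ = begin
      Σ< n (term Δ)                                                                  ≡⟨ Σ<≡sumTo n (term Δ) ⟩
      sumTo n (term Δ)                                                               ≡⟨ cong (λ z → sumTo z (term Δ)) n≡ ⟩
      sumTo (a + (ℓ + suc i)) (term Δ)                                               ≡⟨ sumTo-+ a (ℓ + suc i) (term Δ) ⟩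
      sumTo a (term Δ) + sumTo (ℓ + suc i) (λ j → term Δ (a + j))                    ≡⟨ cong (sumTo a (term Δ) +_) (sumTo-+ ℓ (suc i) (λ j → term Δ (a + j))) ⟩
      sumTo a (term Δ) + (sumTo ℓ (λ j → term Δ (a + j)) + sumTo (suc i) (λ j → term Δ (a + (ℓ + j))))
        ≡⟨ cong (λ z → sumTo a (term Δ) + (z + sumTo (suc i) (λ j → term Δ (a + (ℓ + j))))) (windowRow≡ Δ) ⟨
      sumTo a (term Δ) + (windowRow Δ + sumTo (suc i) (λ j → term Δ (a + (ℓ + j))))  ∎
      where open ≡-Reasoning

    Mx-window-≡ : ∀ Δ Δ′ → AgreeOutside Δ Δ′ → answer V Δ (t₀ + ℓ + i) ≡ answer V Δ′ (t₀ + ℓ + i) → Mx V (window Δ) i ≡ Mx V (window Δ′) i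
    Mx-window-≡ Δ Δ′ agree same-answer = %-+-cancelʳ (windowRow Δ) (windowRow Δ′) (X + Y) q (begin
      (windowRow Δ + (X + Y)) % q          ≡⟨ cong (_% q) (+-comm-middle X (windowRow Δ) Y) ⟨
      (X + (windowRow Δ + Y)) % q          ≡⟨ cong (_% q) (answer-split Δ) ⟨
      answer V Δ (t₀ + ℓ + i)              ≡⟨ same-answer ⟩
      answer V Δ′ (t₀ + ℓ + i)             ≡⟨ cong (_% q) (answer-split Δ′) ⟩
      (sumTo a (term Δ′) + (windowRow Δ′ + sumTo (suc i) (λ j → term Δ′ (a + (ℓ + j))))) % q
        ≡⟨ cong₂ (λ u v → (u + (windowRow Δ′ + v)) % q) (sumTo-cong a (λ p p<a → term-left Δ Δ′ agree p p<a) ) (sumTo-cong (suc i) (λ j j≤i → term-right Δ Δ′ agree j j≤i)) ⟨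
      (X + (windowRow Δ′ + Y)) % q         ≡⟨ cong (_% q) (+-comm-middle X (windowRow Δ′) Y) ⟩
      (windowRow Δ′ + (X + Y)) % q         ∎)
      where
      open ≡-Reasoning
      X = sumTo a (term Δ)
      Y = sumTo (suc i) (λ j → term Δ (a + (ℓ + j)))
      +-comm-middle : ∀ x m y → x + (m + y) ≡ m + (x + y)
      +-comm-middle = solve-∀

  recoverable⇒window-≡ : t₀ + ℓ + ℓ ≤ n → ∀ Δ Δ′ → AgreeOutside Δ Δ′ →
    (∀ i → i < ℓ → answer V Δ (t₀ + ℓ + i) ≡ answer V Δ′ (t₀ + ℓ + i)) →
    ∀ k → recoverable V ℓ k ≡ true → at Δ (t₀ + toℕ k) ≡ at Δ′ (t₀ + toℕ k)
  recoverable⇒window-≡ fits Δ Δ′ agree same-answers k rec = begin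
    at Δ (t₀ + toℕ k)        ≡⟨ at-window Δ (toℕ k) (Fin.toℕ<n k) ⟨
    at x (toℕ k)             ≡⟨ at-lookup x k ⟩
    toℕ (lookup x k)         ≡⟨ ≡ᵇ⇒≡′ x≡x′-at-k ⟩
    toℕ (lookup x′ k)        ≡⟨ at-lookup x′ k ⟨
    at x′ (toℕ k)            ≡⟨ at-window Δ′ (toℕ k) (Fin.toℕ<n k) ⟩
    at Δ′ (t₀ + toℕ k)       ∎
    where
    open ≡-Reasoning
    x = window Δ
    x′ = window Δ′
    same-row : ∀ i → i < ℓ → Mx V x i ≡ Mx V x′ i
    same-row i i<ℓ with a , a+ℓ+i≡n ← m≤n⇒∃[o]m+o≡n (≤-trans (+-monoʳ-≤ ℓ i<ℓ) (≤-trans (m≤n+m (ℓ + ℓ) t₀) (≤-trans (≤-reflexive (sym (+-assoc t₀ ℓ ℓ))) fits)))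
      = Row.Mx-window-≡ i a (sym (trans (+-comm a _) a+ℓ+i≡n)) Δ Δ′ agree (same-answers i i<ℓ)
    same-image : sameImage V x x′ ≡ true
    same-image = all-upTo (λ i → Mx V x i ≡ᵇ Mx V x′ i) ℓ (λ i i<ℓ → subst (λ z → (Mx V x i ≡ᵇ z) ≡ true) (same-row i i<ℓ) (≡ᵇ-refl (Mx V x i)))
    implication : (not (sameImage V x x′) ∨ (toℕ (lookup x k) ≡ᵇ toℕ (lookup x′ k))) ≡ true
    implication = all-≡-true⁻ _ (allVecs q ℓ) (all-≡-true⁻ _ (allVecs q ℓ) rec (∈-allVecs x)) (∈-allVecs x′)
    x≡x′-at-k : (toℕ (lookup x k) ≡ᵇ toℕ (lookup x′ k)) ≡ true
    x≡x′-at-k = subst (λ b → (not b ∨ (toℕ (lookup x k) ≡ᵇ toℕ (lookup x′ k))) ≡ true) same-image implication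

-- The encoding argument

module Encoding (q′ w n : ℕ) (1≤w : 1 ≤ w) (V : Vec (Fin (suc q′)) n) (A : Algo w (suc q′)) (correct : Correct V A)
  (t₀ t₁ t₂ ℓ : ℕ) (t₁≡ : suc t₁ ≡ t₀ + ℓ) (t₂≡ : suc t₂ ≡ t₀ + ℓ + ℓ) (fits : t₀ + ℓ + ℓ ≤ n) where

  q = suc q′
  open Execution A
  open Decoding A t₀ ℓ t₁ t₂ t₁≡ t₂≡
  open Convolution V t₀ ℓ

  recoverableAt : ℕ → Bool
  recoverableAt j with j <? ℓ
  ... | yes j<ℓ = recoverable V ℓ (fromℕ< j<ℓ)
  ... | no _ = false

  recoverableAt-toℕ : ∀ k → recoverableAt (toℕ k) ≡ recoverable V ℓ k
  recoverableAt-toℕ k with toℕ k <? ℓ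
  ... | yes k<ℓ = cong (recoverable V ℓ) (Fin.fromℕ<-toℕ k k<ℓ)
  ... | no k≮ℓ = ⊥-elim (k≮ℓ (Fin.toℕ<n k))

  recoverableAt-true : ∀ j → recoverableAt j ≡ true → Σ (Fin ℓ) (λ k → toℕ k ≡ j × recoverable V ℓ k ≡ true)
  recoverableAt-true j rec with j <? ℓ
  ... | yes j<ℓ = fromℕ< j<ℓ , Fin.toℕ-fromℕ< j<ℓ , rec

  recoverableAt-≥ : ∀ j → ℓ ≤ j → recoverableAt j ≡ false
  recoverableAt-≥ j ℓ≤j with j <? ℓ
  ... | yes j<ℓ = ⊥-elim (<⇒≱ j<ℓ ℓ≤j)
  ... | no _ = refl

  recoverableInput : ℕ → Bool
  recoverableInput i = (t₀ ≤ᵇ i) ∧ recoverableAt (i ∸ t₀)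

  S : Vec Bool n
  S = tabulate (recoverableInput ∘ toℕ)

  selects-S : ∀ i → selects S i ≡ true → t₀ ≤ i × recoverableAt (i ∸ t₀) ≡ true
  selects-S i Si with recoverableInput-i ← selects-tabulate n recoverableInput i Si =
    ≤ᵇ⇒≤ t₀ i (subst T (sym (∧-conicalˡ _ _ recoverableInput-i)) _) , ∧-conicalʳ _ _ recoverableInput-i

  selects-S-outside : ∀ i → (i < t₀ ⊎ t₀ + ℓ ≤ i) → selects S i ≡ false
  selects-S-outside i outside with selects S i in Si
  ... | false = refl
  ... | true with selects-S i Si | outside
  ...   | t₀≤i , _ | inj₁ i<t₀ = ⊥-elim (<⇒≱ i<t₀ t₀≤i)
  ...   | t₀≤i , rec | inj₂ t₀+ℓ≤i with () ← trans (sym rec) (recoverableAt-≥ (i ∸ t₀) (subst (_≤ i ∸ t₀) (m+n∸m≡n t₀ ℓ) (∸-monoˡ-≤ t₀ t₀+ℓ≤i)))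

  selected-S : selected S ≡ R V ℓ
  selected-S with c , t₀+ℓ+c≡n ← m≤n⇒∃[o]m+o≡n (≤-trans (m≤m+n (t₀ + ℓ) ℓ) fits) = begin
    selected S                                                          ≡⟨ selected-tabulate n recoverableInput ⟩
    sumTo n ind                                                         ≡⟨ cong (λ m → sumTo m ind) (trans (sym t₀+ℓ+c≡n) (+-assoc t₀ ℓ c)) ⟩
    sumTo (t₀ + (ℓ + c)) ind                                            ≡⟨ sumTo-+ t₀ (ℓ + c) ind ⟩
    sumTo t₀ ind + sumTo (ℓ + c) (λ j → ind (t₀ + j))                   ≡⟨ cong₂ _+_ (sumTo-zero t₀ ind before) (sumTo-+ ℓ c (λ j → ind (t₀ + j))) ⟩
    0 + (sumTo ℓ (λ j → ind (t₀ + j)) + sumTo c (λ j → ind (t₀ + (ℓ + j))))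
      ≡⟨ cong₂ _+_ (sumTo-cong ℓ (λ j _ → cong indicator (inside j))) (sumTo-zero c _ (λ j _ → after (ℓ + j) (m≤m+n ℓ j))) ⟩
    sumTo ℓ (indicator ∘ recoverableAt) + 0                             ≡⟨ +-identityʳ _ ⟩
    sumTo ℓ (indicator ∘ recoverableAt)                                 ≡⟨ count-tabulate ℓ (recoverable V ℓ) id recoverableAt recoverableAt-toℕ ⟨
    R V ℓ                                                               ∎
    where
    open ≡-Reasoning
    ind = indicator ∘ recoverableInput
    before : ∀ i → i < t₀ → ind i ≡ 0
    before i i<t₀ rewrite ≰⇒≤ᵇ≡false {t₀} {i} (<⇒≱ i<t₀) = refl
    inside : ∀ j → recoverableInput (t₀ + j) ≡ recoverableAt j
    inside j rewrite ≤⇒≤ᵇ≡true (m≤m+n t₀ j) | m+n∸m≡n t₀ j = refl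
    after : ∀ j → ℓ ≤ j → ind (t₀ + j) ≡ 0
    after j ℓ≤j rewrite inside j | recoverableAt-≥ j ℓ≤j = refl

  private
    long : ∀ (Δ : Vec (Fin q) n) → t₀ + ℓ + ℓ ≤ length (toL Δ)
    long Δ = subst (t₀ + ℓ + ℓ ≤_) (sym (length-toL Δ)) fits

  past-≡ : ∀ Δ Δ′ → AgreeOutside Δ Δ′ → past (toL Δ) ≡ past (toL Δ′)
  past-≡ Δ Δ′ agree = atₗ-extensionality _ _ (trans (length-past (toL Δ) (long Δ)) (sym (length-past (toL Δ′) (long Δ′))))
    (λ i i< → let i<t₀ = subst (i <_) (length-past (toL Δ) (long Δ)) i< in begin
      atₗ (past (toL Δ)) i      ≡⟨ atₗ-take t₀ (toL Δ) i i<t₀ ⟩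
      atₗ (toL Δ) i             ≡⟨ at≡atₗ-toL Δ i ⟨
      at Δ i                    ≡⟨ agree i (inj₁ i<t₀) ⟩
      at Δ′ i                   ≡⟨ at≡atₗ-toL Δ′ i ⟩
      atₗ (toL Δ′) i            ≡⟨ atₗ-take t₀ (toL Δ′) i i<t₀ ⟨
      atₗ (past (toL Δ′)) i     ∎)
    where open ≡-Reasoning

  probed-≡ : ∀ Δ Δ′ → AgreeOutside Δ Δ′ → probed (toL Δ) ≡ probed (toL Δ′)
  probed-≡ Δ Δ′ agree = atₗ-extensionality _ _ (trans (length-probed (toL Δ) (long Δ)) (sym (length-probed (toL Δ′) (long Δ′))))
    (λ i i< → let i<ℓ = subst (i <_) (length-probed (toL Δ) (long Δ)) i< in
      trans (atₗ-probed Δ i i<ℓ) (trans (agree (t₀ + (ℓ + i)) (inj₂ (+-monoʳ-≤ t₀ (m≤m+n ℓ i)))) (sym (atₗ-probed Δ′ i i<ℓ))))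
    where
    atₗ-probed : ∀ Δ i → i < ℓ → atₗ (probed (toL Δ)) i ≡ at Δ (t₀ + (ℓ + i))
    atₗ-probed Δ i i<ℓ = trans (atₗ-take ℓ _ i i<ℓ) (trans (atₗ-drop ℓ (drop t₀ (toL Δ)) i)
                           (trans (atₗ-drop t₀ (toL Δ) (ℓ + i)) (sym (at≡atₗ-toL Δ _))))

  overwrite-agree : ∀ Δ r r′ → AgreeOutside (overwrite S Δ r) (overwrite S Δ r′)
  overwrite-agree Δ r r′ p outside =
    trans (overwrite-unselected S Δ r p (selects-S-outside p outside)) (sym (overwrite-unselected S Δ r′ p (selects-S-outside p outside)))

  answer≡nth-outputs-probed : ∀ (Δ : Vec (Fin q) n) i → i < ℓ → answer V Δ (t₀ + ℓ + i) ≡ nth (map toℕ (outputs-probed (toL Δ))) i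
  answer≡nth-outputs-probed Δ i i<ℓ = begin
    answer V Δ (t₀ + ℓ + i)                                    ≡⟨ nth-map-upTo (answer V Δ) n _ t<n ⟨
    nth (map (answer V Δ) (upTo n)) (t₀ + ℓ + i)               ≡⟨ cong (λ z → nth z (t₀ + ℓ + i)) (correct Δ) ⟨
    nth (map toℕ (outputs 0 (init A) (toL Δ))) (t₀ + ℓ + i)    ≡⟨ nth-outputs-probed (toL Δ) (long Δ) i i<ℓ ⟩
    nth (map toℕ (outputs-probed (toL Δ))) i                   ∎
    where
    open ≡-Reasoning
    t<n : t₀ + ℓ + i < n
    t<n = ≤-trans (+-monoʳ-< (t₀ + ℓ) i<ℓ) fits

  message-injective : ∀ Δ r r′ → message (toL (overwrite S Δ r)) ≡ message (toL (overwrite S Δ r′)) → r ≡ r′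
  message-injective Δ r r′ same-message = overwrite-injective S Δ r r′ same-selected
    where
    Δᵣ = overwrite S Δ r
    Δᵣ′ = overwrite S Δ r′
    agree = overwrite-agree Δ r r′
    same-outputs : outputs-probed (toL Δᵣ) ≡ outputs-probed (toL Δᵣ′)
    same-outputs = outputs-probed-determined (toL Δᵣ) (toL Δᵣ′) (long Δᵣ) (long Δᵣ′) (past-≡ Δᵣ Δᵣ′ agree) (probed-≡ Δᵣ Δᵣ′ agree) same-message
    same-answers : ∀ i → i < ℓ → answer V Δᵣ (t₀ + ℓ + i) ≡ answer V Δᵣ′ (t₀ + ℓ + i)
    same-answers i i<ℓ = trans (answer≡nth-outputs-probed Δᵣ i i<ℓ)
      (trans (cong (λ os → nth (map toℕ os) i) same-outputs) (sym (answer≡nth-outputs-probed Δᵣ′ i i<ℓ)))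
    same-selected : ∀ i → selects S i ≡ true → at Δᵣ i ≡ at Δᵣ′ i
    same-selected i Si with t₀≤i , rec ← selects-S i Si with k , k≡ , rec-k ← recoverableAt-true (i ∸ t₀) rec =
      subst (λ p → at Δᵣ p ≡ at Δᵣ′ p) (trans (cong (t₀ +_) k≡) (m+[n∸m]≡n t₀≤i))
        (recoverable⇒window-≡ fits Δᵣ Δᵣ′ agree same-answers k rec-k)

  ITsize≡length-message : ∀ Δ → ITsize {w} {q} {n} A Δ t₀ t₁ t₂ ≡ length (message (toL Δ))
  ITsize≡length-message Δ = trans (count≡length-filterᵇ (transferred (toL Δ)) (allFin (2 ^ w)))
                                  (sym (Listₚ.length-map _ (filterᵇ (transferred (toL Δ)) (allFin (2 ^ w)))))

  length-message≤ : ∀ L → length (message L) ≤ 2 ^ w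
  length-message≤ L = begin
    length (message L)                               ≡⟨ Listₚ.length-map _ (filterᵇ (transferred L) (allFin (2 ^ w))) ⟩
    length (filterᵇ (transferred L) (allFin (2 ^ w))) ≤⟨ Listₚ.length-filter (T? ∘ transferred L) (allFin (2 ^ w)) ⟩
    length (allFin (2 ^ w))                          ≡⟨ length-allFin (2 ^ w) ⟩
    2 ^ w                                            ∎
    where open ≤-Reasoning

  Q : ℕ
  Q = q ^ selected S

  bits : Vec (Fin q) n → ℕ
  bits Δ = codeBits w (ITsize {w} {q} {n} A Δ t₀ t₁ t₂)

  -- The Q fillings of the selected coordinates give Q distinct messages.
  Q^Q≤2^∑bits : ∀ Δ → Q ^ Q ≤ 2 ^ ∑ (allVecs q (selected S)) (λ r → bits (overwrite S Δ r))
  Q^Q≤2^∑bits Δ = subst₂ _≤_ (cong (λ z → z ^ z) length-msgs) (cong (2 ^_) ∑-msgs)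
    (Unique-codes-bits w 1≤w msgs (Unique.map⁺ (message-injective Δ _ _) (allVecs-Unique q (selected S)))
      (All.map⁺ (All.tabulate (λ {r} _ → length-message≤ (toL (overwrite S Δ r))))))
    where
    msg : Vec (Fin q) (selected S) → List (Cell w × Word w)
    msg r = message (toL (overwrite S Δ r))
    msgs = map msg (allVecs q (selected S))
    length-msgs : length msgs ≡ Q
    length-msgs = trans (Listₚ.length-map msg (allVecs q (selected S))) (length-allVecs q (selected S))
    ∑-msgs : ∑ msgs (codeBits w ∘ length) ≡ ∑ (allVecs q (selected S)) (λ r → bits (overwrite S Δ r))
    ∑-msgs = trans (∑-map msg (allVecs q (selected S)) (codeBits w ∘ length))
                   (∑-cong (allVecs q (selected S)) (λ r → cong (codeBits w) (sym (ITsize≡length-message (overwrite S Δ r)))))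

  ∑bits≡ : ∑ (allVecs q n) bits ≡ 2 * w * ITtotal {w} {q} {n} A t₀ t₁ t₂ + w * q ^ n
  ∑bits≡ = begin
    ∑ (allVecs q n) (λ Δ → 2 * w * IT Δ + w)                       ≡⟨ ∑-+ (allVecs q n) (λ Δ → 2 * w * IT Δ) (λ _ → w) ⟩
    ∑ (allVecs q n) (λ Δ → 2 * w * IT Δ) + ∑ (allVecs q n) (λ _ → w) ≡⟨ cong₂ _+_ (sym (*-distribˡ-∑ (2 * w) (allVecs q n) IT)) (∑-const (allVecs q n) w) ⟩
    2 * w * ∑ (allVecs q n) IT + length (allVecs q n) * w           ≡⟨ cong (λ z → 2 * w * ∑ (allVecs q n) IT + z * w) (length-allVecs q n) ⟩
    2 * w * ∑ (allVecs q n) IT + q ^ n * w                          ≡⟨ cong (2 * w * ∑ (allVecs q n) IT +_) (*-comm (q ^ n) w) ⟩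
    2 * w * ∑ (allVecs q n) IT + w * q ^ n                          ∎
    where
    open ≡-Reasoning
    IT : Vec (Fin q) n → ℕ
    IT Δ = ITsize {w} {q} {n} A Δ t₀ t₁ t₂

  -- Multiply the bounds Q^Q≤2^∑bits over all q^n contexts and take the Q-th root.
  bound : q ^ (R V ℓ * q ^ n) ≤ 2 ^ (2 * w * ITtotal {w} {q} {n} A t₀ t₁ t₂ + w * q ^ n)
  bound = subst₂ (λ s T → q ^ (s * q ^ n) ≤ 2 ^ T) selected-S ∑bits≡
    (^-cancelʳ-≤ (q ^ (selected S * q ^ n)) (2 ^ ∑ (allVecs q n) bits) Q {{m^n≢0 q (selected S)}} (begin
      (q ^ (selected S * q ^ n)) ^ Q           ≡⟨ reassociate ⟩
      (Q ^ Q) ^ (q ^ n)                        ≡⟨ cong ((Q ^ Q) ^_) (length-allVecs q n) ⟨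
      (Q ^ Q) ^ length (allVecs q n)           ≤⟨ ^length≤^∑ 2 (Q ^ Q) (allVecs q n) _ Q^Q≤2^∑bits ⟩
      2 ^ ∑ (allVecs q n) (λ Δ → ∑ (allVecs q (selected S)) (λ r → bits (overwrite S Δ r)))
                                               ≡⟨ cong (2 ^_) (∑-overwrite q n S bits) ⟨
      2 ^ (Q * ∑ (allVecs q n) bits)           ≡⟨ cong (2 ^_) (*-comm Q _) ⟩
      2 ^ (∑ (allVecs q n) bits * Q)           ≡⟨ ^-*-assoc 2 (∑ (allVecs q n) bits) Q ⟨
      (2 ^ ∑ (allVecs q n) bits) ^ Q           ∎))
    where
    open ≤-Reasoning
    ^-cancelʳ-≤ : ∀ x y k .{{_ : NonZero k}} → x ^ k ≤ y ^ k → x ≤ y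
    ^-cancelʳ-≤ x y k xᵏ≤yᵏ = ≮⇒≥ (λ y<x → <⇒≱ (^-monoˡ-< k y<x) xᵏ≤yᵏ)
    reassociate : (q ^ (selected S * q ^ n)) ^ Q ≡ (Q ^ Q) ^ (q ^ n)
    reassociate = begin-equality
      (q ^ (selected S * q ^ n)) ^ Q   ≡⟨ ^-*-assoc q (selected S * q ^ n) Q ⟩
      q ^ (selected S * q ^ n * Q)     ≡⟨ cong (q ^_) (exponent (selected S) (q ^ n) Q) ⟩
      q ^ (selected S * Q * q ^ n)     ≡⟨ ^-*-assoc q (selected S * Q) (q ^ n) ⟨
      (q ^ (selected S * Q)) ^ q ^ n   ≡⟨ cong (_^ q ^ n) (^-*-assoc q (selected S) Q) ⟨
      (Q ^ Q) ^ q ^ n                  ∎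
      where
      exponent : ∀ a b c → a * b * c ≡ a * c * b
      exponent = solve-∀

corollary1 : (n q w : ℕ) → 1 ≤ n → .{{_ : NonZero q}} → 1 ≤ w →
    (V : Vec (Fin q) n) → (A : Algo w q) → Correct V A →
    (t₀ t₁ t₂ ℓ : ℕ) → t₀ ≤ t₁ → t₁ < t₂ → t₂ < n →
    suc t₁ ∸ t₀ ≡ ℓ → t₂ ∸ t₁ ≡ ℓ →
    q ^ (R V ℓ * q ^ n) ≤ 2 ^ (2 * w * ITtotal {w} {q} {n} A t₀ t₁ t₂ + w * q ^ n)
corollary1 n (suc q′) w _ 1≤w V A correct t₀ t₁ t₂ ℓ t₀≤t₁ t₁<t₂ t₂<n ℓ≡₁ ℓ≡₂ =
  Encoding.bound q′ w n 1≤w V A correct t₀ t₁ t₂ ℓ 1+t₁≡ 1+t₂≡ (subst (_≤ n) 1+t₂≡ t₂<n)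
  where
  1+t₁≡ : suc t₁ ≡ t₀ + ℓ
  1+t₁≡ = trans (sym (m+[n∸m]≡n (≤-trans t₀≤t₁ (n≤1+n t₁)))) (cong (t₀ +_) ℓ≡₁)
  1+t₂≡ : suc t₂ ≡ t₀ + ℓ + ℓ
  1+t₂≡ = trans (cong suc (trans (sym (m+[n∸m]≡n (<⇒≤ t₁<t₂))) (cong (t₁ +_) ℓ≡₂))) (cong (_+ ℓ) 1+t₁≡)
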